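{- In the setting described, let $0\le d<d_0$ and $r_1,s_1\in\mathbb N$. Then $$\mathcal H_d(r_1)\mathcal H_d(s_1)=\mathcal H_d(r_1+s_1)+\sum_{i+j=r_1+s_1}\Delta^{i,j}_{r_1,s_1}\mathcal H_d(i,j),$$ the sum being over pairs of positive integers $(i,j)$.
   Context: Let $r$ be a power of a prime $p$, $A=\mathbb F_r[\theta]$, $A_{<d}$ the polynomials of degree $<d$ (including $0$), $A_+$ the monic polynomials. Let $\mathbb K$ be an integral domain containing $\mathbb F_r$, $d_0\in\mathbb N$, and suppose each $a\in A_{<d_0}$ is assigned $[a]\in\mathbb K$ such that: $[a]\in\mathbb K^\times$ for every monic $a$ of degree $<d_0$; $[a+b]=[a]+[b]$ for $a,b\in A_{<d_0}$; $[\varepsilon a]=\varepsilon[a]$ for $\varepsilon\in\mathbb F_r$. For $\mathbf s=(s_1,\dots,s_m)$ a tuple of positive integers and $0\le d<d_0$, $\mathcal H_d(\mathbf s)=\sum[a_1]^{ -s_1}\cdots[a_m]^{ -s_m}$ over monic $a_1,\dots,a_m$ with $d=\deg a_1>\cdots>\deg a_m\ge0$. For $r_1,s_1\in\mathbb N$ and positive integers $i,j$, $\Delta^{i,j}_{r_1,s_1}=(-1)^{r_1-1}\binom{j-1}{r_1-1}+(-1)^{s_1-1}\binom{j-1}{s_1-1}$ if $(r-1)\mid j$, and $0$ otherwise (binomials reduced mod $p$). -}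

module Defs where

open import Level using (Level; _⊔_)
open import Algebra.Bundles using (CommutativeRing; Semiring)
open import Data.Empty using (⊥-elim)
open import Data.Nat as ℕ using (ℕ; zero; suc; _∸_; _<_; _<?_; _≟_)
open import Data.Nat.Properties using (<-irrefl; <-asym; <-trans; n<1+n)
open import Data.Nat.Divisibility using (_∣?_)
open import Data.Nat.Combinatorics using (_C_)
open import Data.Fin using (Fin; toℕ; fromℕ<)
open import Data.Fin.Properties using (toℕ-fromℕ<)
open import Data.Vec as Vec using (Vec; lookup; tabulate; zipWith)
open import Data.Vec.Properties using (lookup∘tabulate)
open import Data.List as List using (List; []; _∷_; concatMap; allFin; upTo; foldr)
open import Data.Product using (Σ; _×_; _,_; proj₁)
open import Data.Sum using (_⊎_)
open import Relation.Nullary using (¬_; yes; no; does)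
open import Data.Bool using (if_then_else_)
open import Relation.Binary.PropositionalEquality using (_≡_; refl; sym; trans; subst)

record IsIntegralDomain {c ℓ : Level} (R : CommutativeRing c ℓ) : Set (c ⊔ ℓ) where
  open CommutativeRing R hiding (sym; trans; refl)
  field
    1≉0        : ¬ (1# ≈ 0#)
    noZeroDivs : ∀ x y → x * y ≈ 0# → x ≈ 0# ⊎ y ≈ 0#

-- A subring of K with exactly r elements, enumerated injectively by Fin r.
-- (A finite subring of an integral domain is a field, so this is a copy of F_r in K.)
record FiniteSubfield {c ℓ : Level} (R : CommutativeRing c ℓ) (r : ℕ) : Set (c ⊔ ℓ) where
  open CommutativeRing R hiding (sym; trans; refl)
  field
    emb      : Fin r → Carrier
    emb-inj  : ∀ x y → emb x ≈ emb y → x ≡ y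
    𝟘 𝟙      : Fin r
    emb-𝟘    : emb 𝟘 ≈ 0#
    emb-𝟙    : emb 𝟙 ≈ 1#
    _⊕_ _⊗_  : Fin r → Fin r → Fin r
    ⊖_       : Fin r → Fin r
    emb-⊕    : ∀ x y → emb (x ⊕ y) ≈ emb x + emb y
    emb-⊗    : ∀ x y → emb (x ⊗ y) ≈ emb x * emb y
    emb-⊖    : ∀ x → emb (⊖ x) ≈ - emb x

module Setting {c ℓ : Level} (R : CommutativeRing c ℓ) {r : ℕ} (F : FiniteSubfield R r) (d₀ : ℕ) where
  open CommutativeRing R hiding (sym; trans; refl)
  open FiniteSubfield F
  open import Algebra.Definitions.RawSemiring (Semiring.rawSemiring semiring) using (_^_) renaming (_×_ to _×ᴷ_)

  -- A_{<d₀}: polynomials in θ over F_r of degree < d₀, as coefficient vectors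
  -- (entry i is the coefficient of θ^i).
  Poly : Set
  Poly = Vec (Fin r) d₀

  _+ₚ_ : Poly → Poly → Poly
  a +ₚ b = zipWith _⊕_ a b

  _·ₚ_ : Fin r → Poly → Poly
  ε ·ₚ a = Vec.map (ε ⊗_) a

  IsMonic : Poly → Set
  IsMonic a = Σ (Fin d₀) λ k → lookup a k ≡ 𝟙 × (∀ i → toℕ k < toℕ i → lookup a i ≡ 𝟘)

  monicCoeff : (d : ℕ) → Vec (Fin r) d → Fin d₀ → Fin r
  monicCoeff d cs i with toℕ i <? d
  ... | yes q = lookup cs (fromℕ< q)
  ... | no _ with toℕ i ≟ d
  ...   | yes _ = 𝟙
  ...   | no _  = 𝟘

  monicPoly : (d : ℕ) → d < d₀ → Vec (Fin r) d → Poly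
  monicPoly d p cs = tabulate (monicCoeff d cs)

  monicPoly-isMonic : ∀ d (p : d < d₀) cs → IsMonic (monicPoly d p cs)
  monicPoly-isMonic d p cs = fromℕ< p , lead , high
    where
    k≡d : toℕ (fromℕ< p) ≡ d
    k≡d = toℕ-fromℕ< p
    lead : lookup (monicPoly d p cs) (fromℕ< p) ≡ 𝟙
    lead rewrite lookup∘tabulate (monicCoeff d cs) (fromℕ< p) with toℕ (fromℕ< p) <? d
    ... | yes q = ⊥-elim (<-irrefl k≡d q)
    ... | no _ with toℕ (fromℕ< p) ≟ d
    ...   | yes _ = refl
    ...   | no ne = ⊥-elim (ne k≡d)
    high : ∀ i → toℕ (fromℕ< p) < toℕ i → lookup (monicPoly d p cs) i ≡ 𝟘
    high i lt rewrite lookup∘tabulate (monicCoeff d cs) i | k≡d with toℕ i <? d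
    ... | yes q = ⊥-elim (<-asym lt q)
    ... | no _ with toℕ i ≟ d
    ...   | yes e = ⊥-elim (<-irrefl (sym e) lt)
    ...   | no _ = refl

  vecs : (n : ℕ) → List (Vec (Fin r) n)
  vecs zero = Vec.[] ∷ []
  vecs (suc n) = concatMap (λ x → List.map (x Vec.∷_) (vecs n)) (allFin r)

  ΣK : ∀ {A : Set} → List A → (A → Carrier) → Carrier
  ΣK xs f = foldr (λ x acc → f x + acc) 0# xs

  module Sums (br : Poly → Carrier)
              (unit : ∀ a → IsMonic a → Σ Carrier λ y → br a * y ≈ 1#) where

    inv : ∀ d (p : d < d₀) cs → Carrier
    inv d p cs = proj₁ (unit (monicPoly d p cs) (monicPoly-isMonic d p cs))

    mutual
      -- H_d(s_1,...,s_m) (for m ≥ 1; the value on [] is 1 and is not used)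
      H : (d : ℕ) → d < d₀ → List ℕ → Carrier
      H d p [] = 1#
      H d p (s ∷ ss) = ΣK (vecs d) (λ cs → (inv d p cs ^ s) * H< d p ss)

      H< : (d : ℕ) → d < d₀ → List ℕ → Carrier
      H< d p [] = 1#
      H< zero p (t ∷ ts) = 0#
      H< (suc e) p (t ∷ ts) = H e (<-trans (n<1+n e) p) (t ∷ ts) + H< e (<-trans (n<1+n e) p) (t ∷ ts)

  -- binomial coefficient n C k as element of K (hence reduced mod the characteristic p)
  -- Δ^{i,j}_{r₁,s₁}
  Δ : ℕ → ℕ → ℕ → ℕ → Carrier
  Δ r₁ s₁ i j = if does ((r ∸ 1) ∣? j)
                then ((- 1#) ^ (r₁ ∸ 1)) * (((j ∸ 1) C (r₁ ∸ 1)) ×ᴷ 1#)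
                     + ((- 1#) ^ (s₁ ∸ 1)) * (((j ∸ 1) C (s₁ ∸ 1)) ×ᴷ 1#)
                else 0#

  ΣPairs : ℕ → (ℕ → ℕ → Carrier) → Carrier
  ΣPairs n f = ΣK (upTo (n ∸ 1)) (λ k → f (suc k) (n ∸ suc k))

{-# OPTIONS --safe #-}
-- Write x_a = [a]⁻¹ for the monic a = θ^d + (lower terms). For a ≠ b the difference
-- u = a − b has degree < d, [a] = [b] + [u], so x = x_a, y = x_b and w = [u]⁻¹ satisfy
-- x y = w (y − x). Iterating this relation gives the partial-fraction expansion
--   x^r y^s = Σ_{i+j=r+s} ((−1)^s C(j−1,s−1) x^i + (−1)^(r+j) C(j−1,r−1) y^i) w^j.
-- Write u = ε (θ^e + c) with ε ∈ F_r^×, deg c < e, so that w = ε⁻¹ [θ^e + c]⁻¹. Summing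
-- over a (for fixed u), then over c and e, and finally over ε produces H_d(i), H_{<d}(j) and
-- the power sum Σ_{ε≠0} ε^(−j), which is −1 when (r−1) ∣ j and 0 otherwise (Fermat, plus
-- X^(g+1) − X having at most g + 1 roots). The diagonal a = b contributes H_d(r+s).
module Submission where

open import Algebra.Bundles using (CommutativeMonoid; CommutativeRing; Semiring)
open import Algebra.Solver.Ring.AlmostCommutativeRing using (fromCommutativeRing; _-Raw-AlmostCommutative⟶_)
open import Data.Bool using (if_then_else_)
open import Data.Empty using (⊥-elim)
open import Data.Fin as Fin using (Fin)
import Data.Fin.Properties as Fin
open import Data.Fin.Permutation as Permutation using (Permutation′; permutation; _⟨$⟩ʳ_)
open import Data.Integer as ℤ using (ℤ; +_; -[1+_]; +[1+_])
import Data.Integer.Properties as ℤ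
open import Data.List as List using (List; []; _∷_; _++_; foldr; allFin; upTo; concatMap; length)
import Data.List.Properties as List
open import Data.List.Relation.Unary.All as All using (All; []; _∷_)
import Data.List.Relation.Unary.All.Properties as All
open import Data.List.Relation.Unary.AllPairs as AllPairs using (AllPairs; []; _∷_)
import Data.List.Relation.Unary.AllPairs.Properties as AllPairs
import Data.List.Relation.Unary.Unique.Propositional.Properties as Unique
open import Data.Maybe using (Maybe; map)
open import Data.Nat as ℕ using (ℕ; zero; suc; _∸_)
import Data.Nat.Properties as ℕ
open import Data.Nat.DivMod using (_%_; _/_; m≡m%n+[m/n]*n; m%n<n)
open import Data.Nat.Divisibility using (_∣_; _∣?_; divides; m%n≡0⇒n∣m)
open import Data.Product using (Σ; ∃; _,_; proj₂)
open import Data.Sign as Sign using (Sign)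
open import Data.Sum using ([_,_]′)
open import Data.Vec as Vec using (Vec; []; _∷_; lookup; tabulate; zipWith; replicate; _∷ʳ_)
import Data.Vec.Properties as Vec
open import Function using (_∘_)
open import Level using (Level; _⊔_)
open import Relation.Binary.Consequences using (dec⇒weaklyDec)
open import Relation.Binary.PropositionalEquality as ≡ using (_≡_; _≢_)
open import Relation.Nullary using (¬_; yes; no; does; ¬?)
open import Relation.Nullary.Decidable using (_×-dec_; dec-true; dec-false)

open import Defs

-- The standard library's ring solver needs a coefficient ring with decidable equality;
-- ℤ, mapped into R, provides one. The optimised _×_ makes fromℤ (+ 1) reduce to 1#.
module IntegerCoefficientSolver {c ℓ} (R : CommutativeRing c ℓ) where
  open CommutativeRing R
  open import Algebra.Properties.Ring ring using (-‿distribˡ-*; -‿distribʳ-*)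
  open import Algebra.Properties.AbelianGroup +-abelianGroup using (⁻¹-∙-comm)
  open import Algebra.Properties.Group +-group using (ε⁻¹≈ε; ⁻¹-involutive)
  open import Algebra.Properties.Semiring.Mult.TCOptimised semiring using (_×_; 1+×; ×-homo-+; ×1-homo-*)
  open import Relation.Binary.Reasoning.Setoid setoid

  fromℤ : ℤ → Carrier
  fromℤ (+ n) = n × 1#
  fromℤ -[1+ n ] = - (suc n × 1#)

  fromℤ-‿homo : ∀ i → fromℤ (ℤ.- i) ≈ - fromℤ i
  fromℤ-‿homo (+ zero) = sym ε⁻¹≈ε
  fromℤ-‿homo +[1+ n ] = refl
  fromℤ-‿homo -[1+ n ] = sym (⁻¹-involutive _)

  fromℤ-⊖ : ∀ m n → fromℤ (m ℤ.⊖ n) ≈ m × 1# - n × 1#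
  fromℤ-⊖ zero zero = sym (trans (+-congˡ ε⁻¹≈ε) (+-identityʳ _))
  fromℤ-⊖ (suc m) zero = sym (trans (+-congˡ ε⁻¹≈ε) (+-identityʳ _))
  fromℤ-⊖ zero (suc n) = sym (+-identityˡ _)
  fromℤ-⊖ (suc m) (suc n) = begin
    fromℤ (suc m ℤ.⊖ suc n)              ≡⟨ ≡.cong fromℤ (ℤ.[1+m]⊖[1+n]≡m⊖n m n) ⟩
    fromℤ (m ℤ.⊖ n)                      ≈⟨ fromℤ-⊖ m n ⟩
    m × 1# - n × 1#                      ≈⟨ +-identityˡ _ ⟨
    0# + (m × 1# - n × 1#)               ≈⟨ +-congʳ (-‿inverseʳ 1#) ⟨
    (1# - 1#) + (m × 1# - n × 1#)        ≈⟨ +-assoc _ _ _ ⟩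
    1# + (- 1# + (m × 1# - n × 1#))      ≈⟨ +-congˡ (+-congˡ (+-comm _ _)) ⟩
    1# + (- 1# + (- (n × 1#) + m × 1#))  ≈⟨ +-congˡ (+-assoc _ _ _) ⟨
    1# + ((- 1# - n × 1#) + m × 1#)      ≈⟨ +-congˡ (+-comm _ _) ⟩
    1# + (m × 1# + (- 1# - n × 1#))      ≈⟨ +-assoc _ _ _ ⟨
    (1# + m × 1#) + (- 1# - n × 1#)      ≈⟨ +-congˡ (⁻¹-∙-comm _ _) ⟩
    (1# + m × 1#) - (1# + n × 1#)        ≈⟨ +-cong (1+× m 1#) (-‿cong (1+× n 1#)) ⟨
    suc m × 1# - suc n × 1#              ∎

  fromℤ-+-homo : ∀ i j → fromℤ (i ℤ.+ j) ≈ fromℤ i + fromℤ j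
  fromℤ-+-homo (+ m) (+ n) = ×-homo-+ 1# m n
  fromℤ-+-homo (+ m) -[1+ n ] = fromℤ-⊖ m (suc n)
  fromℤ-+-homo -[1+ m ] (+ n) = trans (fromℤ-⊖ n (suc m)) (+-comm _ _)
  fromℤ-+-homo -[1+ m ] -[1+ n ] = begin
    - (suc (suc (m ℕ.+ n)) × 1#)     ≡⟨ ≡.cong (λ k → - (suc k × 1#)) (ℕ.+-suc m n) ⟨
    - ((suc m ℕ.+ suc n) × 1#)       ≈⟨ -‿cong (×-homo-+ 1# (suc m) (suc n)) ⟩
    - (suc m × 1# + suc n × 1#)      ≈⟨ ⁻¹-∙-comm _ _ ⟨
    - (suc m × 1#) + - (suc n × 1#)  ∎

  signed : Sign → Carrier → Carrier
  signed Sign.+ x = x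
  signed Sign.- x = - x

  fromℤ-◃ : ∀ s n → fromℤ (s ℤ.◃ n) ≈ signed s (n × 1#)
  fromℤ-◃ Sign.+ n = reflexive (≡.cong fromℤ (ℤ.+◃n≡+n n))
  fromℤ-◃ Sign.- n = trans (reflexive (≡.cong fromℤ (ℤ.-◃n≡-n n))) (fromℤ-‿homo (+ n))

  signed-* : ∀ s t x y → signed (s Sign.* t) (x * y) ≈ signed s x * signed t y
  signed-* Sign.+ Sign.+ x y = refl
  signed-* Sign.+ Sign.- x y = -‿distribʳ-* x y
  signed-* Sign.- Sign.+ x y = -‿distribˡ-* x y
  signed-* Sign.- Sign.- x y = begin
    x * y          ≈⟨ ⁻¹-involutive _ ⟨
    - - (x * y)    ≈⟨ -‿cong (-‿distribˡ-* x y) ⟩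
    - (- x * y)    ≈⟨ -‿distribʳ-* _ _ ⟩
    - x * - y      ∎

  signed-cong : ∀ s {x y} → x ≈ y → signed s x ≈ signed s y
  signed-cong Sign.+ x≈y = x≈y
  signed-cong Sign.- x≈y = -‿cong x≈y

  fromℤ-signed : ∀ i → fromℤ i ≈ signed (ℤ.sign i) (ℤ.∣ i ∣ × 1#)
  fromℤ-signed (+ n) = refl
  fromℤ-signed -[1+ n ] = refl

  fromℤ-*-homo : ∀ i j → fromℤ (i ℤ.* j) ≈ fromℤ i * fromℤ j
  fromℤ-*-homo i j = begin
    fromℤ (i ℤ.* j)                                        ≈⟨ fromℤ-◃ (s Sign.* t) (ℤ.∣ i ∣ ℕ.* ℤ.∣ j ∣) ⟩
    signed (s Sign.* t) ((ℤ.∣ i ∣ ℕ.* ℤ.∣ j ∣) × 1#)        ≈⟨ signed-cong (s Sign.* t) (×1-homo-* ℤ.∣ i ∣ ℤ.∣ j ∣) ⟩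
    signed (s Sign.* t) ((ℤ.∣ i ∣ × 1#) * (ℤ.∣ j ∣ × 1#))   ≈⟨ signed-* s t _ _ ⟩
    signed s (ℤ.∣ i ∣ × 1#) * signed t (ℤ.∣ j ∣ × 1#)      ≈⟨ *-cong (fromℤ-signed i) (fromℤ-signed j) ⟨
    fromℤ i * fromℤ j                                      ∎
    where
    s = ℤ.sign i
    t = ℤ.sign j

  ℤ⟶R : ℤ.+-*-rawRing -Raw-AlmostCommutative⟶ fromCommutativeRing R
  ℤ⟶R = record
    { ⟦_⟧    = fromℤ
    ; +-homo = fromℤ-+-homo
    ; *-homo = fromℤ-*-homo
    ; -‿homo = fromℤ-‿homo
    ; 0-homo = refl
    ; 1-homo = refl
    }

  fromℤ-≟ : ∀ i j → Maybe (fromℤ i ≈ fromℤ j)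
  fromℤ-≟ i j = map (reflexive ∘ ≡.cong fromℤ) (dec⇒weaklyDec ℤ._≟_ i j)

  open import Algebra.Solver.Ring ℤ.+-*-rawRing (fromCommutativeRing R) ℤ⟶R fromℤ-≟
    public using (solve; _:+_; _:*_; _:-_; :-_; _:=_; con)

private
  variable
    a b : Level
    A : Set a
    B : Set b

length-allFin : ∀ n → length (allFin n) ≡ n
length-allFin n = List.length-tabulate {n = n} (λ i → i)

injective⇒surjective : ∀ {n} (f : Fin n → Fin n) → (∀ {x y} → f x ≡ f y → x ≡ y) → ∀ y → ∃ λ x → f x ≡ y
injective⇒surjective {zero} f f-inj ()
injective⇒surjective {suc n} f f-inj y with Fin.any? (λ x → f x Fin.≟ y)
... | yes found = found
... | no ∄x = ⊥-elim (ℕ.<-irrefl ≡.refl (Fin.injective⇒≤ g-inj))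
  where
  fx≢y : ∀ x → y ≢ f x
  fx≢y x y≡fx = ∄x (x , ≡.sym y≡fx)
  g : Fin (suc n) → Fin n
  g x = Fin.punchOut (fx≢y x)
  g-inj : ∀ {x x′} → g x ≡ g x′ → x ≡ x′
  g-inj gx≡gx′ = f-inj (Fin.punchOut-injective (fx≢y _) (fx≢y _) gx≡gx′)

module ListSum {c ℓ} (M : CommutativeMonoid c ℓ) where
  open CommutativeMonoid M
  open import Algebra.Properties.CommutativeMonoid.Sum M using (sum; sum-permute)
  open import Algebra.Properties.Monoid.Mult monoid using (_×_)
  open import Algebra.Properties.CommutativeSemigroup commutativeSemigroup using (interchange; x∙yz≈y∙xz)
  open import Relation.Binary.Reasoning.Setoid setoid

  ∑ : List A → (A → Carrier) → Carrier
  ∑ xs f = foldr (λ x acc → f x ∙ acc) ε xs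

  ∑-cong : ∀ (xs : List A) {f g : A → Carrier} → (∀ x → f x ≈ g x) → ∑ xs f ≈ ∑ xs g
  ∑-cong [] f≈g = refl
  ∑-cong (x ∷ xs) f≈g = ∙-cong (f≈g x) (∑-cong xs f≈g)

  ∑-cong-All : ∀ {xs : List A} {f g : A → Carrier} → All (λ x → f x ≈ g x) xs → ∑ xs f ≈ ∑ xs g
  ∑-cong-All [] = refl
  ∑-cong-All (fx≈gx ∷ f≈g) = ∙-cong fx≈gx (∑-cong-All f≈g)

  ∑-zero : ∀ (xs : List A) → ∑ xs (λ _ → ε) ≈ ε
  ∑-zero [] = refl
  ∑-zero (x ∷ xs) = trans (identityˡ _) (∑-zero xs)

  ∑-distrib-∙ : ∀ (xs : List A) (f g : A → Carrier) → ∑ xs (λ x → f x ∙ g x) ≈ ∑ xs f ∙ ∑ xs g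
  ∑-distrib-∙ [] f g = sym (identityˡ ε)
  ∑-distrib-∙ (x ∷ xs) f g = trans (∙-congˡ (∑-distrib-∙ xs f g)) (interchange _ _ _ _)

  ∑-++ : ∀ (xs ys : List A) (f : A → Carrier) → ∑ (xs ++ ys) f ≈ ∑ xs f ∙ ∑ ys f
  ∑-++ [] ys f = sym (identityˡ _)
  ∑-++ (x ∷ xs) ys f = trans (∙-congˡ (∑-++ xs ys f)) (sym (assoc _ _ _))

  ∑-const : ∀ (xs : List A) k → ∑ xs (λ _ → k) ≈ length xs × k
  ∑-const [] k = refl
  ∑-const (x ∷ xs) k = ∙-congˡ (∑-const xs k)

  ∑-map : (g : B → A) (xs : List B) (f : A → Carrier) → ∑ (List.map g xs) f ≡ ∑ xs (f ∘ g)
  ∑-map g [] f = ≡.refl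
  ∑-map g (x ∷ xs) f = ≡.cong (f (g x) ∙_) (∑-map g xs f)

  ∑-concatMap : (h : B → List A) (xs : List B) (f : A → Carrier) →
                ∑ (concatMap h xs) f ≈ ∑ xs (λ x → ∑ (h x) f)
  ∑-concatMap h [] f = refl
  ∑-concatMap h (x ∷ xs) f = trans (∑-++ (h x) (concatMap h xs) f) (∙-congˡ (∑-concatMap h xs f))

  ∑-comm : (xs : List A) (ys : List B) (f : A → B → Carrier) →
           ∑ xs (λ x → ∑ ys (f x)) ≈ ∑ ys (λ y → ∑ xs (λ x → f x y))
  ∑-comm [] ys f = sym (∑-zero ys)
  ∑-comm (x ∷ xs) ys f = trans (∙-congˡ (∑-comm xs ys f)) (sym (∑-distrib-∙ ys (f x) _))

  ∑-upTo-suc : ∀ n (f : ℕ → Carrier) → ∑ (upTo (suc n)) f ≈ ∑ (upTo n) f ∙ f n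
  ∑-upTo-suc n f = begin
    ∑ (upTo (suc n)) f        ≡⟨ ≡.cong (λ xs → ∑ xs f) (List.upTo-∷ʳ n) ⟨
    ∑ (upTo n List.∷ʳ n) f    ≈⟨ ∑-++ (upTo n) (n ∷ []) f ⟩
    ∑ (upTo n) f ∙ (f n ∙ ε)  ≈⟨ ∙-congˡ (identityʳ _) ⟩
    ∑ (upTo n) f ∙ f n        ∎

  ∑-upTo-cong : ∀ n {f g : ℕ → Carrier} → (∀ k → k ℕ.< n → f k ≈ g k) → ∑ (upTo n) f ≈ ∑ (upTo n) g
  ∑-upTo-cong zero f≈g = refl
  ∑-upTo-cong (suc n) {f} {g} f≈g = begin
    ∑ (upTo (suc n)) f  ≈⟨ ∑-upTo-suc n f ⟩
    ∑ (upTo n) f ∙ f n  ≈⟨ ∙-cong (∑-upTo-cong n (λ k k<n → f≈g k (ℕ.m<n⇒m<1+n k<n))) (f≈g n ℕ.≤-refl) ⟩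
    ∑ (upTo n) g ∙ g n  ≈⟨ ∑-upTo-suc n g ⟨
    ∑ (upTo (suc n)) g  ∎

  ∑-allFin : ∀ {n} (f : Fin n → Carrier) → ∑ (allFin n) f ≡ sum f
  ∑-allFin {n} f = go (λ i → i)
    where
    go : ∀ {m} (g : Fin m → Fin n) → ∑ (List.tabulate g) f ≡ sum (f ∘ g)
    go {zero} g = ≡.refl
    go {suc m} g = ≡.cong (f (g Fin.zero) ∙_) (go (g ∘ Fin.suc))

  ∑-allFin-permute : ∀ {n} (π : Permutation′ n) (f : Fin n → Carrier) →
                     ∑ (allFin n) (λ i → f (π ⟨$⟩ʳ i)) ≈ ∑ (allFin n) f
  ∑-allFin-permute π f = begin
    ∑ (allFin _) (λ i → f (π ⟨$⟩ʳ i))  ≡⟨ ∑-allFin (λ i → f (π ⟨$⟩ʳ i)) ⟩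
    sum (λ i → f (π ⟨$⟩ʳ i))           ≈⟨ sum-permute f π ⟨
    sum f                              ≡⟨ ∑-allFin f ⟨
    ∑ (allFin _) f                     ∎

  private
    _except_ : ∀ {n} → (Fin n → Carrier) → Fin n → Fin n → Carrier
    (f except a) i = if does (i Fin.≟ a) then ε else f i

    ∑-filter : ∀ {n} (a : Fin n) xs f → ∑ (List.filter (λ i → ¬? (i Fin.≟ a)) xs) f ≈ ∑ xs (f except a)
    ∑-filter a [] f = refl
    ∑-filter a (x ∷ xs) f with x Fin.≟ a
    ... | yes _ = trans (∑-filter a xs f) (sym (identityˡ _))
    ... | no _ = ∙-congˡ (∑-filter a xs f)

    sum-cong : ∀ {n} {g h : Fin n → Carrier} → (∀ i → g i ≡ h i) → sum g ≈ sum h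
    sum-cong {zero} g≡h = refl
    sum-cong {suc n} g≡h = ∙-cong (reflexive (g≡h Fin.zero)) (sum-cong (g≡h ∘ Fin.suc))

    except-suc : ∀ {n} (a : Fin n) (f : Fin (suc n) → Carrier) i → ((f ∘ Fin.suc) except a) i ≡ (f except Fin.suc a) (Fin.suc i)
    except-suc a f i with i Fin.≟ a
    ... | yes _ = ≡.refl
    ... | no _ = ≡.refl

    sum-extract : ∀ {n} (a : Fin n) (f : Fin n → Carrier) → sum f ≈ f a ∙ sum (f except a)
    sum-extract Fin.zero f = ∙-congˡ (sym (identityˡ _))
    sum-extract (Fin.suc a) f = begin
      f Fin.zero ∙ sum (f ∘ Fin.suc)                              ≈⟨ ∙-congˡ (sum-extract a (f ∘ Fin.suc)) ⟩
      f Fin.zero ∙ (f (Fin.suc a) ∙ sum ((f ∘ Fin.suc) except a)) ≈⟨ x∙yz≈y∙xz _ _ _ ⟩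
      f (Fin.suc a) ∙ (f Fin.zero ∙ sum ((f ∘ Fin.suc) except a)) ≈⟨ ∙-congˡ (∙-congˡ (sum-cong (except-suc a f))) ⟩
      f (Fin.suc a) ∙ sum (f except Fin.suc a)                    ∎

    except-permute : ∀ {n} (π : Permutation′ n) a f → (∀ i → π ⟨$⟩ʳ i ≡ a → i ≡ a) → π ⟨$⟩ʳ a ≡ a →
                     ∀ i → ((λ j → f (π ⟨$⟩ʳ j)) except a) i ≈ (f except a) (π ⟨$⟩ʳ i)
    except-permute π a f πi≡a⇒i≡a πa≡a i with i Fin.≟ a | π ⟨$⟩ʳ i Fin.≟ a
    ... | yes _    | yes _    = refl
    ... | yes i≡a  | no πi≢a  = ⊥-elim (πi≢a (≡.trans (≡.cong (π ⟨$⟩ʳ_) i≡a) πa≡a))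
    ... | no i≢a   | yes πi≡a = ⊥-elim (i≢a (πi≡a⇒i≡a i πi≡a))
    ... | no _     | no _     = refl

  allFinExcept : ∀ {n} → Fin n → List (Fin n)
  allFinExcept a = List.filter (λ i → ¬? (i Fin.≟ a)) (allFin _)

  ∑-allFin-extract : ∀ {n} (a : Fin n) (f : Fin n → Carrier) → ∑ (allFin n) f ≈ f a ∙ ∑ (allFinExcept a) f
  ∑-allFin-extract {n} a f = begin
    ∑ (allFin n) f                   ≡⟨ ∑-allFin f ⟩
    sum f                            ≈⟨ sum-extract a f ⟩
    f a ∙ sum (f except a)           ≡⟨ ≡.cong (f a ∙_) (∑-allFin (f except a)) ⟨
    f a ∙ ∑ (allFin n) (f except a)  ≈⟨ ∙-congˡ (∑-filter a (allFin n) f) ⟨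
    f a ∙ ∑ (allFinExcept a) f       ∎

  ∑-allFinExcept-permute : ∀ {n} (π : Permutation′ n) a f → (∀ i → π ⟨$⟩ʳ i ≡ a → i ≡ a) → π ⟨$⟩ʳ a ≡ a →
                           ∑ (allFinExcept a) (λ i → f (π ⟨$⟩ʳ i)) ≈ ∑ (allFinExcept a) f
  ∑-allFinExcept-permute {n} π a f πi≡a⇒i≡a πa≡a = begin
    ∑ (allFinExcept a) (λ i → f (π ⟨$⟩ʳ i))          ≈⟨ ∑-filter a (allFin n) _ ⟩
    ∑ (allFin n) ((λ i → f (π ⟨$⟩ʳ i)) except a)      ≈⟨ ∑-cong (allFin n) (except-permute π a f πi≡a⇒i≡a πa≡a) ⟩
    ∑ (allFin n) (λ i → (f except a) (π ⟨$⟩ʳ i))      ≈⟨ ∑-allFin-permute π (f except a) ⟩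
    ∑ (allFin n) (f except a)                         ≈⟨ ∑-filter a (allFin n) f ⟨
    ∑ (allFinExcept a) f                              ∎

module RingSum {c ℓ} (R : CommutativeRing c ℓ) where
  open CommutativeRing R
  open ListSum +-commutativeMonoid public

  *-distribˡ-∑ : ∀ k (xs : List A) f → k * ∑ xs f ≈ ∑ xs (λ x → k * f x)
  *-distribˡ-∑ k [] f = zeroʳ k
  *-distribˡ-∑ k (x ∷ xs) f = trans (distribˡ _ _ _) (+-congˡ (*-distribˡ-∑ k xs f))

  *-distribʳ-∑ : ∀ k (xs : List A) f → ∑ xs f * k ≈ ∑ xs (λ x → f x * k)
  *-distribʳ-∑ k xs f = trans (*-comm _ _) (trans (*-distribˡ-∑ k xs f) (∑-cong xs (λ _ → *-comm _ _)))

module RingPowers {c ℓ} (R : CommutativeRing c ℓ) where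
  open CommutativeRing R hiding (zero)
  open import Algebra.Definitions.RawSemiring (Semiring.rawSemiring semiring) using (_^_)
  open import Algebra.Properties.Semiring.Exp semiring using (^-congˡ; ^-assocʳ)
  open import Relation.Binary.Reasoning.Setoid setoid

  1^n≈1 : ∀ n → 1# ^ n ≈ 1#
  1^n≈1 zero = refl
  1^n≈1 (suc n) = trans (*-identityˡ _) (1^n≈1 n)

  ^-∣ : ∀ {x} m {j} → x ^ m ≈ 1# → m ∣ j → x ^ j ≈ 1#
  ^-∣ {x} m {j} x^m≈1 (divides q j≡q*m) = begin
    x ^ j            ≡⟨ ≡.cong (x ^_) (≡.trans j≡q*m (ℕ.*-comm q m)) ⟩
    x ^ (m ℕ.* q)    ≈⟨ ^-assocʳ x m q ⟨
    (x ^ m) ^ q      ≈⟨ ^-congˡ q x^m≈1 ⟩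
    1# ^ q           ≈⟨ 1^n≈1 q ⟩
    1#               ∎

module PairSums {c ℓ} (R : CommutativeRing c ℓ) where
  open CommutativeRing R hiding (zero)
  open RingSum R
  open import Relation.Binary.Reasoning.Setoid setoid

  antidiagonalSum : ℕ → (ℕ → ℕ → Carrier) → Carrier
  antidiagonalSum zero g = g 0 0
  antidiagonalSum (suc n) g = g 0 (suc n) + antidiagonalSum n (λ a b → g (suc a) b)

  antidiagonalSum-suc : ∀ n g → antidiagonalSum (suc n) g ≈ antidiagonalSum n (λ a b → g a (suc b)) + g (suc n) 0
  antidiagonalSum-suc zero g = refl
  antidiagonalSum-suc (suc n) g = trans (+-congˡ (antidiagonalSum-suc n (λ a b → g (suc a) b))) (sym (+-assoc _ _ _))

  antidiagonalSum-cong : ∀ n {g h} → (∀ a b → a ℕ.+ b ≡ n → g a b ≈ h a b) → antidiagonalSum n g ≈ antidiagonalSum n h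
  antidiagonalSum-cong zero g≈h = g≈h 0 0 ≡.refl
  antidiagonalSum-cong (suc n) g≈h = +-cong (g≈h 0 (suc n) ≡.refl) (antidiagonalSum-cong n (λ a b eq → g≈h (suc a) b (≡.cong suc eq)))

  antidiagonalSum-distrib-+ : ∀ n g h → antidiagonalSum n (λ a b → g a b + h a b) ≈ antidiagonalSum n g + antidiagonalSum n h
  antidiagonalSum-distrib-+ zero g h = refl
  antidiagonalSum-distrib-+ (suc n) g h = trans (+-congˡ (antidiagonalSum-distrib-+ n _ _)) (interchange _ _ _ _)
    where open import Algebra.Properties.CommutativeSemigroup +-commutativeSemigroup using (interchange)

  *-distribˡ-antidiagonalSum : ∀ n k g → k * antidiagonalSum n g ≈ antidiagonalSum n (λ a b → k * g a b)
  *-distribˡ-antidiagonalSum zero k g = refl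
  *-distribˡ-antidiagonalSum (suc n) k g = trans (distribˡ _ _ _) (+-congˡ (*-distribˡ-antidiagonalSum n k _))

  -‿distrib-antidiagonalSum : ∀ n g → - antidiagonalSum n g ≈ antidiagonalSum n (λ a b → - g a b)
  -‿distrib-antidiagonalSum zero g = refl
  -‿distrib-antidiagonalSum (suc n) g = trans (sym (⁻¹-∙-comm _ _)) (+-congˡ (-‿distrib-antidiagonalSum n _))
    where open import Algebra.Properties.AbelianGroup +-abelianGroup using (⁻¹-∙-comm)

  -- Σ_{i+j=n, i,j≥1} f i j: the body of ΣPairs in Defs, over any commutative ring.
  sumPairs : ℕ → (ℕ → ℕ → Carrier) → Carrier
  sumPairs n f = ∑ (upTo (n ∸ 1)) (λ k → f (suc k) (n ∸ suc k))

  sumPairs-antidiagonalSum : ∀ n f → sumPairs (2 ℕ.+ n) f ≈ antidiagonalSum n (λ a b → f (suc a) (suc b))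
  sumPairs-antidiagonalSum n f = go n (λ a b → f (suc a) b)
    where
    go : ∀ n (g : ℕ → ℕ → Carrier) → ∑ (upTo (suc n)) (λ k → g k (suc n ∸ k)) ≈ antidiagonalSum n (λ a b → g a (suc b))
    go zero g = +-identityʳ _
    go (suc n) g = +-congˡ (begin
      ∑ (List.applyUpTo suc (suc n)) (λ k → g k (2 ℕ.+ n ∸ k))
        ≡⟨ ≡.cong (λ ks → ∑ ks (λ k → g k (2 ℕ.+ n ∸ k))) (List.map-applyUpTo (λ k → k) suc (suc n)) ⟨
      ∑ (List.map suc (upTo (suc n))) (λ k → g k (2 ℕ.+ n ∸ k))
        ≡⟨ ∑-map suc (upTo (suc n)) _ ⟩
      ∑ (upTo (suc n)) (λ k → g (suc k) (suc n ∸ k))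
        ≈⟨ go n (λ a b → g (suc a) b) ⟩
      antidiagonalSum n (λ a b → g (suc a) (suc b)) ∎)

  ∑-sumPairs : ∀ (xs : List A) n (f : A → ℕ → ℕ → Carrier) →
               ∑ xs (λ x → sumPairs n (f x)) ≈ sumPairs n (λ i j → ∑ xs (λ x → f x i j))
  ∑-sumPairs xs n f = ∑-comm xs (upTo (n ∸ 1)) _

module PartialFractions {c ℓ} (R : CommutativeRing c ℓ) where
  open CommutativeRing R hiding (zero)
  open import Algebra.Definitions.RawSemiring (Semiring.rawSemiring semiring) using (_^_; _×_)
  open import Algebra.Properties.Semiring.Mult semiring using (×-homo-+)
  open import Data.Nat.Combinatorics using (_C_; nCk+nC[k+1]≡[n+1]C[k+1]; nCk≡nC[n∸k]; nCn≡1; k>n⇒nCk≡0)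
  open IntegerCoefficientSolver R
  open PairSums R
  open import Relation.Binary.Reasoning.Setoid setoid

  sign : ℕ → Carrier
  sign k = (- 1#) ^ k

  binomial : ℕ → ℕ → Carrier
  binomial n k = (n C k) × 1#

  binomial-pascal : ∀ n k → binomial (suc n) (suc k) ≈ binomial n k + binomial n (suc k)
  binomial-pascal n k = trans (reflexive (≡.cong (_× 1#) (≡.sym (nCk+nC[k+1]≡[n+1]C[k+1] n k)))) (×-homo-+ 1# (n C k) (n C suc k))

  binomial-zero : ∀ n → binomial n 0 ≈ 1#
  binomial-zero n = trans (reflexive (≡.cong (_× 1#) (≡.trans (nCk≡nC[n∸k] {0} {n} ℕ.z≤n) (nCn≡1 n)))) (+-identityʳ 1#)

  binomial-> : ∀ {n k} → n ℕ.< k → binomial n k ≈ 0#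
  binomial-> n<k = reflexive (≡.cong (_× 1#) (k>n⇒nCk≡0 n<k))

  leftCoeff rightCoeff : ℕ → ℕ → Carrier
  leftCoeff s j = sign s * binomial (j ∸ 1) (s ∸ 1)
  rightCoeff r j = sign j * sign r * binomial (j ∸ 1) (r ∸ 1)

  -- sign (suc k) unfolds to - 1# * sign k, which the solver calls read as :- con (+ 1) :* S.
  leftCoeff-pascal : ∀ s b → leftCoeff (2 ℕ.+ s) (2 ℕ.+ b) ≈ leftCoeff (2 ℕ.+ s) (1 ℕ.+ b) - leftCoeff (1 ℕ.+ s) (1 ℕ.+ b)
  leftCoeff-pascal s b = trans (*-congˡ (binomial-pascal b s))
    (solve 3 (λ S B B′ → (:- con (+ 1) :* S) :* (B :+ B′) := (:- con (+ 1) :* S) :* B′ :- S :* B) refl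
      (sign (1 ℕ.+ s)) (binomial b s) (binomial b (1 ℕ.+ s)))

  rightCoeff-pascal : ∀ r b → rightCoeff (2 ℕ.+ r) (2 ℕ.+ b) ≈ rightCoeff (1 ℕ.+ r) (1 ℕ.+ b) - rightCoeff (2 ℕ.+ r) (1 ℕ.+ b)
  rightCoeff-pascal r b = trans (*-congˡ (binomial-pascal b r))
    (solve 4 (λ Sb Sr B B′ → (:- con (+ 1) :* Sb) :* (:- con (+ 1) :* Sr) :* (B :+ B′)
                             := Sb :* Sr :* B :- Sb :* (:- con (+ 1) :* Sr) :* B′) refl
      (sign (1 ℕ.+ b)) (sign (1 ℕ.+ r)) (binomial b r) (binomial b (1 ℕ.+ r)))

  leftCoeff-one : ∀ b → leftCoeff 1 (2 ℕ.+ b) ≈ leftCoeff 1 (1 ℕ.+ b)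
  leftCoeff-one b = *-congˡ (trans (binomial-zero (suc b)) (sym (binomial-zero b)))

  rightCoeff-one : ∀ b → rightCoeff 1 (2 ℕ.+ b) ≈ - rightCoeff 1 (1 ℕ.+ b)
  rightCoeff-one b = begin
    sign (2 ℕ.+ b) * sign 1 * binomial (suc b) 0    ≈⟨ *-congˡ (trans (binomial-zero (suc b)) (sym (binomial-zero b))) ⟩
    sign (2 ℕ.+ b) * sign 1 * binomial b 0          ≈⟨ solve 3 (λ S P B → (:- con (+ 1) :* S) :* P :* B := :- (S :* P :* B)) refl _ _ _ ⟩
    - (sign (1 ℕ.+ b) * sign 1 * binomial b 0)      ∎

  leftCoeff-vanish : ∀ {s b} → b ℕ.≤ s → leftCoeff (2 ℕ.+ s) (1 ℕ.+ b) ≈ 0#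
  leftCoeff-vanish b≤s = trans (*-congˡ (binomial-> (ℕ.s≤s b≤s))) (zeroʳ _)

  rightCoeff-vanish : ∀ {r b} → b ℕ.≤ r → rightCoeff (2 ℕ.+ r) (1 ℕ.+ b) ≈ 0#
  rightCoeff-vanish b≤r = trans (*-congˡ (binomial-> (ℕ.s≤s b≤r))) (zeroʳ _)

  term : ℕ → ℕ → Carrier → Carrier → Carrier → ℕ → ℕ → Carrier
  term r s x y w i j = (leftCoeff s j * x ^ i + rightCoeff r j * y ^ i) * w ^ j

  reciprocal-difference : ∀ {X Y C x y w} → X ≈ Y + C → X * x ≈ 1# → Y * y ≈ 1# → C * w ≈ 1# → x * y ≈ w * y - w * x
  reciprocal-difference {X} {Y} {C} {x} {y} {w} X≈Y+C Xx≈1 Yy≈1 Cw≈1 = begin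
    x * y
      ≈⟨ *-identityʳ _ ⟨
    (x * y) * 1#
      ≈⟨ *-congˡ Cw≈1 ⟨
    (x * y) * (C * w)                                           ≈⟨ solve 6 (λ x y w X Y C → (x :* y) :* (C :* w)
                                                                     := w :* y :* (X :* x) :- w :* x :* (Y :* y) :+ (x :* y :* w) :* (Y :+ C :- X)) refl x y w X Y C ⟩
    w * y * (X * x) - w * x * (Y * y) + (x * y * w) * (Y + C - X)
      ≈⟨ +-cong (+-cong (*-congˡ Xx≈1) (-‿cong (*-congˡ Yy≈1))) (*-congˡ (+-congʳ (sym X≈Y+C))) ⟩
    w * y * 1# - w * x * 1# + (x * y * w) * (X - X)
      ≈⟨ solve 4 (λ x y w X → w :* y :* con (+ 1) :- w :* x :* con (+ 1) :+ (x :* y :* w) :* (X :- X) := w :* y :- w :* x) refl x y w X ⟩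
    w * y - w * x ∎

  module _ {x y w : Carrier} (xy≈wy-wx : x * y ≈ w * y - w * x) where

    private
      t : ℕ → ℕ → ℕ → ℕ → Carrier
      t r s = term r s x y w

    expansion : ℕ → ℕ → Carrier
    expansion r s = antidiagonalSum (r ℕ.+ s) (λ a b → t (suc r) (suc s) (suc a) (suc b))

    private
      peel : ∀ X Y → (x * X) * (y * Y) ≈ w * (X * (y * Y)) - w * ((x * X) * Y)
      peel X Y = begin
        (x * X) * (y * Y)
          ≈⟨ solve 4 (λ x y X Y → (x :* X) :* (y :* Y) := (x :* y) :* (X :* Y)) refl x y X Y ⟩
        (x * y) * (X * Y)
          ≈⟨ *-congʳ xy≈wy-wx ⟩
        (w * y - w * x) * (X * Y)
          ≈⟨ solve 5 (λ x y w X Y → (w :* y :- w :* x) :* (X :* Y) := w :* (X :* (y :* Y)) :- w :* ((x :* X) :* Y)) refl x y w X Y ⟩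
        w * (X * (y * Y)) - w * ((x * X) * Y) ∎

      shift : ∀ {l l′ ρ ρ′} X Y W → l ≈ l′ → ρ ≈ ρ′ → (l * X + ρ * Y) * (w * W) ≈ w * ((l′ * X + ρ′ * Y) * W)
      shift {l′ = l′} {ρ′ = ρ′} X Y W l≈ ρ≈ = trans (*-congʳ (+-cong (*-congʳ l≈) (*-congʳ ρ≈)))
        (solve 6 (λ w l ρ X Y W → (l :* X :+ ρ :* Y) :* (w :* W) := w :* ((l :* X :+ ρ :* Y) :* W)) refl w l′ ρ′ X Y W)

      shift-neg : ∀ {l l′ ρ ρ′} X Y W → l ≈ - l′ → ρ ≈ - ρ′ →
                  (l * X + ρ * Y) * (w * W) ≈ - (w * ((l′ * X + ρ′ * Y) * W))
      shift-neg {l′ = l′} {ρ′ = ρ′} X Y W l≈ ρ≈ = trans (*-congʳ (+-cong (*-congʳ l≈) (*-congʳ ρ≈)))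
        (solve 6 (λ w l ρ X Y W → (:- l :* X :+ :- ρ :* Y) :* (w :* W) := :- (w :* ((l :* X :+ ρ :* Y) :* W))) refl w l′ ρ′ X Y W)

      shift-sub : ∀ {l l′ l″ ρ ρ′ ρ″} X Y W → l ≈ l′ - l″ → ρ ≈ ρ′ - ρ″ →
                  (l * X + ρ * Y) * (w * W) ≈ w * ((l′ * X + ρ′ * Y) * W) - w * ((l″ * X + ρ″ * Y) * W)
      shift-sub {l′ = l′} {l″} {ρ′ = ρ′} {ρ″} X Y W l≈ ρ≈ = trans (*-congʳ (+-cong (*-congʳ l≈) (*-congʳ ρ≈)))
        (solve 8 (λ w l′ l″ ρ′ ρ″ X Y W → ((l′ :- l″) :* X :+ (ρ′ :- ρ″) :* Y) :* (w :* W)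
                                         := w :* ((l′ :* X :+ ρ′ :* Y) :* W) :- w :* ((l″ :* X :+ ρ″ :* Y) :* W))
          refl w l′ l″ ρ′ ρ″ X Y W)

      last-vanish : ∀ {l ρ} X Y → l ≈ 0# → ρ ≈ 0# → (l * X + ρ * Y) * (w * 1#) ≈ 0#
      last-vanish X Y l≈0 ρ≈0 = trans (*-congʳ (+-cong (*-congʳ l≈0) (*-congʳ ρ≈0)))
        (solve 3 (λ X Y w → (con (+ 0) :* X :+ con (+ 0) :* Y) :* (w :* con (+ 1)) := con (+ 0)) refl X Y w)

      w*-antidiagonal : ∀ n g h → w * antidiagonalSum n g - w * antidiagonalSum n h ≈ antidiagonalSum n (λ a b → w * g a b - w * h a b)
      w*-antidiagonal n g h = begin
        w * antidiagonalSum n g - w * antidiagonalSum n h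
          ≈⟨ +-cong (*-distribˡ-antidiagonalSum n w g) (-‿cong (*-distribˡ-antidiagonalSum n w h)) ⟩
        antidiagonalSum n (λ a b → w * g a b) - antidiagonalSum n (λ a b → w * h a b)
          ≈⟨ +-congˡ (-‿distrib-antidiagonalSum n _) ⟩
        antidiagonalSum n (λ a b → w * g a b) + antidiagonalSum n (λ a b → - (w * h a b))
          ≈⟨ antidiagonalSum-distrib-+ n _ _ ⟨
        antidiagonalSum n (λ a b → w * g a b - w * h a b) ∎

    x^r*y^s≈expansion : ∀ r s → x ^ suc r * y ^ suc s ≈ expansion r s
    x^r*y^s≈expansion zero zero = begin
      (x * 1#) * (y * 1#)  ≈⟨ solve 2 (λ x y → (x :* con (+ 1)) :* (y :* con (+ 1)) := x :* y) refl x y ⟩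
      x * y                ≈⟨ xy≈wy-wx ⟩
      w * y - w * x        ≈⟨ solve 3 (λ x y w → w :* y :- w :* x
                                := ((:- con (+ 1) :* con (+ 1)) :* con (+ 1) :* (x :* con (+ 1))
                                   :+ (:- con (+ 1) :* con (+ 1)) :* (:- con (+ 1) :* con (+ 1)) :* con (+ 1) :* (y :* con (+ 1)))
                                   :* (w :* con (+ 1))) refl x y w ⟩
      (sign 1 * 1# * x ^ 1 + sign 1 * sign 1 * 1# * y ^ 1) * w ^ 1
        ≈⟨ *-congʳ (+-cong (*-congʳ (*-congˡ (binomial-zero 0))) (*-congʳ (*-congˡ (binomial-zero 0)))) ⟨
      expansion 0 0        ∎
    x^r*y^s≈expansion (suc r) zero = begin
      (x * x ^ suc r) * (y * 1#)
        ≈⟨ peel (x ^ suc r) 1# ⟩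
      w * (x ^ suc r * (y * 1#)) - w * ((x * x ^ suc r) * 1#)
        ≈⟨ +-cong (*-congˡ (x^r*y^s≈expansion r zero)) (-‿cong (*-congˡ (*-identityʳ _))) ⟩
      w * expansion r 0 - w * x ^ (2 ℕ.+ r)
        ≈⟨ +-cong (*-distribˡ-antidiagonalSum (r ℕ.+ 0) w _) (sym last) ⟩
      antidiagonalSum (r ℕ.+ 0) (λ a b → w * t (1 ℕ.+ r) 1 (suc a) (suc b)) + h (suc (r ℕ.+ 0)) 0
        ≈⟨ +-congʳ (antidiagonalSum-cong (r ℕ.+ 0) (λ a b a+b≡r → sym (step a b a+b≡r))) ⟩
      antidiagonalSum (r ℕ.+ 0) (λ a b → h a (suc b)) + h (suc (r ℕ.+ 0)) 0
        ≈⟨ antidiagonalSum-suc (r ℕ.+ 0) h ⟨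
      expansion (suc r) 0 ∎
      where
      h : ℕ → ℕ → Carrier
      h a b = t (2 ℕ.+ r) 1 (suc a) (suc b)
      step : ∀ a b → a ℕ.+ b ≡ r ℕ.+ 0 → h a (suc b) ≈ w * t (1 ℕ.+ r) 1 (suc a) (suc b)
      step a b a+b≡r = shift _ _ _ (leftCoeff-one b)
        (trans (rightCoeff-pascal r b) (trans (+-congˡ (-‿cong (rightCoeff-vanish b≤r))) (trans (+-congˡ ε⁻¹≈ε) (+-identityʳ _))))
        where
        open import Algebra.Properties.Group +-group using (ε⁻¹≈ε)
        b≤r : b ℕ.≤ r
        b≤r = ℕ.≤-trans (ℕ.m≤n+m b a) (ℕ.≤-reflexive (≡.trans a+b≡r (ℕ.+-identityʳ r)))
      last : h (suc (r ℕ.+ 0)) 0 ≈ - (w * x ^ (2 ℕ.+ r))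
      last = begin
        (leftCoeff 1 1 * x ^ (2 ℕ.+ (r ℕ.+ 0)) + rightCoeff (2 ℕ.+ r) 1 * y ^ (2 ℕ.+ (r ℕ.+ 0))) * w ^ 1
          ≡⟨ ≡.cong (λ k → (leftCoeff 1 1 * x ^ (2 ℕ.+ k) + rightCoeff (2 ℕ.+ r) 1 * y ^ (2 ℕ.+ (r ℕ.+ 0))) * w ^ 1) (ℕ.+-identityʳ r) ⟩
        (leftCoeff 1 1 * x ^ (2 ℕ.+ r) + rightCoeff (2 ℕ.+ r) 1 * y ^ (2 ℕ.+ (r ℕ.+ 0))) * w ^ 1
          ≈⟨ *-congʳ (+-cong (*-congʳ (*-congˡ (binomial-zero 0))) (*-congʳ (rightCoeff-vanish {r} ℕ.z≤n))) ⟩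
        ((- 1# * 1#) * 1# * x ^ (2 ℕ.+ r) + 0# * y ^ (2 ℕ.+ (r ℕ.+ 0))) * w ^ 1
          ≈⟨ solve 3 (λ X Y w → ((:- con (+ 1) :* con (+ 1)) :* con (+ 1) :* X :+ con (+ 0) :* Y) :* (w :* con (+ 1)) := :- (w :* X)) refl _ _ w ⟩
        - (w * x ^ (2 ℕ.+ r)) ∎
    x^r*y^s≈expansion zero (suc s) = begin
      (x * 1#) * (y * y ^ suc s)
        ≈⟨ peel 1# (y ^ suc s) ⟩
      w * (1# * (y * y ^ suc s)) - w * ((x * 1#) * y ^ suc s)
        ≈⟨ +-cong (*-congˡ (*-identityˡ _)) (-‿cong (*-congˡ (x^r*y^s≈expansion zero s))) ⟩
      w * y ^ (2 ℕ.+ s) - w * expansion 0 s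
        ≈⟨ +-comm _ _ ⟩
      - (w * expansion 0 s) + w * y ^ (2 ℕ.+ s)
        ≈⟨ +-cong (trans (-‿cong (*-distribˡ-antidiagonalSum s w _)) (-‿distrib-antidiagonalSum s _)) (sym last) ⟩
      antidiagonalSum s (λ a b → - (w * t 1 (1 ℕ.+ s) (suc a) (suc b))) + h (suc s) 0
        ≈⟨ +-congʳ (antidiagonalSum-cong s (λ a b a+b≡s → sym (step a b a+b≡s))) ⟩
      antidiagonalSum s (λ a b → h a (suc b)) + h (suc s) 0
        ≈⟨ antidiagonalSum-suc s h ⟨
      expansion 0 (suc s) ∎
      where
      h : ℕ → ℕ → Carrier
      h a b = t 1 (2 ℕ.+ s) (suc a) (suc b)
      step : ∀ a b → a ℕ.+ b ≡ s → h a (suc b) ≈ - (w * t 1 (1 ℕ.+ s) (suc a) (suc b))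
      step a b a+b≡s = shift-neg _ _ _
        (trans (leftCoeff-pascal s b) (trans (+-congʳ (leftCoeff-vanish b≤s)) (+-identityˡ _)))
        (rightCoeff-one b)
        where
        b≤s : b ℕ.≤ s
        b≤s = ℕ.≤-trans (ℕ.m≤n+m b a) (ℕ.≤-reflexive a+b≡s)
      last : h (suc s) 0 ≈ w * y ^ (2 ℕ.+ s)
      last = begin
        (leftCoeff (2 ℕ.+ s) 1 * x ^ (2 ℕ.+ s) + rightCoeff 1 1 * y ^ (2 ℕ.+ s)) * w ^ 1
          ≈⟨ *-congʳ (+-cong (*-congʳ (leftCoeff-vanish {s} ℕ.z≤n)) (*-congʳ (*-congˡ (binomial-zero 0)))) ⟩
        (0# * x ^ (2 ℕ.+ s) + (- 1# * 1#) * (- 1# * 1#) * 1# * y ^ (2 ℕ.+ s)) * w ^ 1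
          ≈⟨ solve 3 (λ X Y w → (con (+ 0) :* X :+ (:- con (+ 1) :* con (+ 1)) :* (:- con (+ 1) :* con (+ 1)) :* con (+ 1) :* Y)
                                 :* (w :* con (+ 1)) := w :* Y) refl _ _ w ⟩
        w * y ^ (2 ℕ.+ s) ∎
    x^r*y^s≈expansion (suc r) (suc s) = begin
      (x * x ^ suc r) * (y * y ^ suc s)
        ≈⟨ peel (x ^ suc r) (y ^ suc s) ⟩
      w * (x ^ suc r * (y * y ^ suc s)) - w * ((x * x ^ suc r) * y ^ suc s)
        ≈⟨ +-cong (*-congˡ (x^r*y^s≈expansion r (suc s))) (-‿cong (*-congˡ (x^r*y^s≈expansion (suc r) s))) ⟩
      w * expansion r (suc s) - w * antidiagonalSum (suc (r ℕ.+ s)) h₂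
        ≡⟨ ≡.cong (λ n → w * expansion r (suc s) - w * antidiagonalSum n h₂) (ℕ.+-suc r s) ⟨
      w * antidiagonalSum n h₁ - w * antidiagonalSum n h₂       ≈⟨ w*-antidiagonal n h₁ h₂ ⟩
      antidiagonalSum n (λ a b → w * h₁ a b - w * h₂ a b)       ≈⟨ antidiagonalSum-cong n (λ a b _ → sym (step a b)) ⟩
      antidiagonalSum n (λ a b → h a (suc b))                   ≈⟨ +-identityʳ _ ⟨
      antidiagonalSum n (λ a b → h a (suc b)) + 0#              ≈⟨ +-congˡ last ⟨
      antidiagonalSum n (λ a b → h a (suc b)) + h (suc n) 0     ≈⟨ antidiagonalSum-suc n h ⟨
      expansion (suc r) (suc s)                                 ∎
      where
      n = r ℕ.+ suc s
      h h₁ h₂ : ℕ → ℕ → Carrier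
      h a b = t (2 ℕ.+ r) (2 ℕ.+ s) (suc a) (suc b)
      h₁ a b = t (1 ℕ.+ r) (2 ℕ.+ s) (suc a) (suc b)
      h₂ a b = t (2 ℕ.+ r) (1 ℕ.+ s) (suc a) (suc b)
      step : ∀ a b → h a (suc b) ≈ w * h₁ a b - w * h₂ a b
      step a b = shift-sub _ _ _ (leftCoeff-pascal s b) (rightCoeff-pascal r b)
      last : h (suc n) 0 ≈ 0#
      last = last-vanish _ _ (leftCoeff-vanish {s} ℕ.z≤n) (rightCoeff-vanish {r} ℕ.z≤n)

    partialFractions : ∀ r s → x ^ suc r * y ^ suc s ≈ sumPairs (suc r ℕ.+ suc s) (term (suc r) (suc s) x y w)
    partialFractions r s = begin
      x ^ suc r * y ^ suc s                              ≈⟨ x^r*y^s≈expansion r s ⟩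
      expansion r s                                      ≈⟨ sumPairs-antidiagonalSum (r ℕ.+ s) (t (suc r) (suc s)) ⟨
      sumPairs (2 ℕ.+ (r ℕ.+ s)) (t (suc r) (suc s))  ≡⟨ ≡.cong (λ n → sumPairs (suc n) (t (suc r) (suc s))) (ℕ.+-suc r s) ⟨
      sumPairs (suc r ℕ.+ suc s) (term (suc r) (suc s) x y w)  ∎

module IntegralDomainProperties {c ℓ} (R : CommutativeRing c ℓ) (ID : IsIntegralDomain R) where
  open CommutativeRing R
  open IsIntegralDomain ID
  open IntegerCoefficientSolver R
  open import Algebra.Definitions.RawSemiring (Semiring.rawSemiring semiring) using (_^_)
  open import Data.Product using (_×_)
  open import Algebra.Properties.Group +-group using (x∙y⁻¹≈ε⇒x≈y)
  open import Relation.Binary.Reasoning.Setoid setoid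

  *-≉0 : ∀ {x y} → ¬ x ≈ 0# → ¬ y ≈ 0# → ¬ x * y ≈ 0#
  *-≉0 x≉0 y≉0 xy≈0 = [ x≉0 , y≉0 ]′ (noZeroDivs _ _ xy≈0)

  *-cancelˡ : ∀ {x y z} → ¬ x ≈ 0# → x * y ≈ x * z → y ≈ z
  *-cancelˡ {x} {y} {z} x≉0 xy≈xz = x∙y⁻¹≈ε⇒x≈y y z ([ ⊥-elim ∘ x≉0 , (λ y-z≈0 → y-z≈0) ]′ (noZeroDivs x (y - z) (begin
    x * (y - z)    ≈⟨ solve 3 (λ x y z → x :* (y :- z) := x :* y :- x :* z) refl x y z ⟩
    x * y - x * z  ≈⟨ +-congʳ xy≈xz ⟩
    x * z - x * z  ≈⟨ -‿inverseʳ _ ⟩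
    0#             ∎)))

  inverse-unique : ∀ {x y z} → x * y ≈ 1# → x * z ≈ 1# → y ≈ z
  inverse-unique xy≈1 xz≈1 = *-cancelˡ (λ x≈0 → 1≉0 (trans (sym xy≈1) (trans (*-congʳ x≈0) (zeroˡ _)))) (trans xy≈1 (sym xz≈1))

  x≈cx⇒x≈0 : ∀ {c x} → ¬ c ≈ 1# → x ≈ c * x → x ≈ 0#
  x≈cx⇒x≈0 {c} {x} c≉1 x≈cx = [ (λ 1-c≈0 → ⊥-elim (c≉1 (sym (x∙y⁻¹≈ε⇒x≈y 1# c 1-c≈0)))) , (λ x≈0 → x≈0) ]′
    (noZeroDivs (1# - c) x (begin
      (1# - c) * x   ≈⟨ solve 2 (λ c x → (con (+ 1) :- c) :* x := x :- c :* x) refl c x ⟩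
      x - c * x      ≈⟨ +-congʳ x≈cx ⟩
      c * x - c * x  ≈⟨ -‿inverseʳ _ ⟩
      0#             ∎))

  eval : List Carrier → Carrier → Carrier
  eval [] x = 0#
  eval (c ∷ cs) x = c + x * eval cs x

  quotient : List Carrier → Carrier → List Carrier
  quotient [] a = []
  quotient (c ∷ []) a = []
  quotient (c ∷ c′ ∷ cs) a = eval (c′ ∷ cs) a ∷ quotient (c′ ∷ cs) a

  length-quotient : ∀ c cs a → length (quotient (c ∷ cs) a) ≡ length cs
  length-quotient c [] a = ≡.refl
  length-quotient c (c′ ∷ cs) a = ≡.cong suc (length-quotient c′ cs a)

  eval-quotient : ∀ P x a → eval P x ≈ eval P a + (x - a) * eval (quotient P a) x
  eval-quotient [] x a = solve 2 (λ x a → con (+ 0) := con (+ 0) :+ (x :- a) :* con (+ 0)) refl x a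
  eval-quotient (c ∷ []) x a = solve 3 (λ c x a → c :+ x :* con (+ 0) := (c :+ a :* con (+ 0)) :+ (x :- a) :* con (+ 0)) refl c x a
  eval-quotient (c ∷ c′ ∷ cs) x a = begin
    c + x * eval (c′ ∷ cs) x
      ≈⟨ +-congˡ (*-congˡ (eval-quotient (c′ ∷ cs) x a)) ⟩
    c + x * (E + (x - a) * Q)
      ≈⟨ solve 5 (λ c x a E Q → c :+ x :* (E :+ (x :- a) :* Q) := (c :+ a :* E) :+ (x :- a) :* (E :+ x :* Q)) refl c x a E Q ⟩
    (c + a * E) + (x - a) * (E + x * Q) ∎
    where
    E = eval (c′ ∷ cs) a
    Q = eval (quotient (c′ ∷ cs) a) x

  IsZero : List Carrier → Set (c ⊔ ℓ)
  IsZero = All (_≈ 0#)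

  root-of-zero-quotient : ∀ P a → eval P a ≈ 0# → IsZero (quotient P a) → IsZero P
  root-of-zero-quotient [] a Pa≈0 Q≈0 = []
  root-of-zero-quotient (c ∷ []) a Pa≈0 Q≈0 = trans (solve 2 (λ c a → c := c :+ a :* con (+ 0)) refl c a) Pa≈0 ∷ []
  root-of-zero-quotient (c ∷ c′ ∷ cs) a Pa≈0 (E≈0 ∷ Q≈0) = c≈0 ∷ root-of-zero-quotient (c′ ∷ cs) a E≈0 Q≈0
    where
    E = eval (c′ ∷ cs) a
    c≈0 : c ≈ 0#
    c≈0 = begin
      c                  ≈⟨ solve 3 (λ c a E → c := (c :+ a :* E) :- a :* E) refl c a E ⟩
      (c + a * E) - a * E ≈⟨ +-cong Pa≈0 (-‿cong (*-congˡ E≈0)) ⟩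
      0# - a * 0#        ≈⟨ solve 1 (λ a → con (+ 0) :- a :* con (+ 0) := con (+ 0)) refl a ⟩
      0#                 ∎

  many-roots⇒zero : ∀ as P → length P ℕ.≤ length as → AllPairs (λ a b → ¬ a ≈ b) as →
                    All (λ a → eval P a ≈ 0#) as → IsZero P
  many-roots⇒zero as [] _ _ _ = []
  many-roots⇒zero (a ∷ as) (c ∷ cs) (ℕ.s≤s |cs|≤|as|) (a≉as ∷ distinct) (Pa≈0 ∷ Pas≈0) =
    root-of-zero-quotient (c ∷ cs) a Pa≈0
      (many-roots⇒zero as (quotient (c ∷ cs) a) (ℕ.≤-trans (ℕ.≤-reflexive (length-quotient c cs a)) |cs|≤|as|) distinct
        (All.zipWith quotient-root (a≉as , Pas≈0)))
    where
    quotient-root : ∀ {b} → ¬ a ≈ b × eval (c ∷ cs) b ≈ 0# → eval (quotient (c ∷ cs) a) b ≈ 0#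
    quotient-root {b} (a≉b , Pb≈0) = [ ⊥-elim ∘ b-a≉0 , (λ Qb≈0 → Qb≈0) ]′ (noZeroDivs _ _ (begin
      (b - a) * eval (quotient (c ∷ cs) a) b                       ≈⟨ +-identityˡ _ ⟨
      0# + (b - a) * eval (quotient (c ∷ cs) a) b                  ≈⟨ +-congʳ Pa≈0 ⟨
      eval (c ∷ cs) a + (b - a) * eval (quotient (c ∷ cs) a) b     ≈⟨ eval-quotient (c ∷ cs) b a ⟨
      eval (c ∷ cs) b                                              ≈⟨ Pb≈0 ⟩
      0#                                                           ∎))
      where
      b-a≉0 : ¬ b - a ≈ 0#
      b-a≉0 b-a≈0 = a≉b (sym (x∙y⁻¹≈ε⇒x≈y b a b-a≈0))

  monomial : ℕ → List Carrier
  monomial zero = 1# ∷ []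
  monomial (suc m) = 0# ∷ monomial m

  eval-monomial : ∀ m x → eval (monomial m) x ≈ x ^ m
  eval-monomial zero x = trans (+-congˡ (zeroʳ x)) (+-identityʳ 1#)
  eval-monomial (suc m) x = trans (+-identityˡ _) (*-congˡ (eval-monomial m x))

  length-monomial : ∀ m → length (monomial m) ≡ suc m
  length-monomial zero = ≡.refl
  length-monomial (suc m) = ≡.cong suc (length-monomial m)

  monomial-≉0 : ∀ m → ¬ IsZero (monomial m)
  monomial-≉0 zero (1≈0 ∷ []) = 1≉0 1≈0
  monomial-≉0 (suc m) (_ ∷ z) = monomial-≉0 m z

module SubfieldArithmetic {c ℓ} {R : CommutativeRing c ℓ} {r : ℕ} (F : FiniteSubfield R r) where
  open CommutativeRing R hiding (zero)
  open FiniteSubfield F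
  open IntegerCoefficientSolver R

  emb-cancel : ∀ {x y} → emb x ≈ emb y → x ≡ y
  emb-cancel = emb-inj _ _

  ⊗-zeroˡ : ∀ x → 𝟘 ⊗ x ≡ 𝟘
  ⊗-zeroˡ x = emb-cancel (trans (emb-⊗ 𝟘 x) (trans (*-congʳ emb-𝟘) (trans (zeroˡ _) (sym emb-𝟘))))

  ⊗-zeroʳ : ∀ x → x ⊗ 𝟘 ≡ 𝟘
  ⊗-zeroʳ x = emb-cancel (trans (emb-⊗ x 𝟘) (trans (*-congˡ emb-𝟘) (trans (zeroʳ _) (sym emb-𝟘))))

  ⊗-comm : ∀ x y → x ⊗ y ≡ y ⊗ x
  ⊗-comm x y = emb-cancel (trans (emb-⊗ x y) (trans (*-comm _ _) (sym (emb-⊗ y x))))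

  ⊕-identityʳ : ∀ x → x ⊕ 𝟘 ≡ x
  ⊕-identityʳ x = emb-cancel (trans (emb-⊕ _ _) (trans (+-congˡ emb-𝟘) (+-identityʳ _)))

  ⊗-identityʳ : ∀ x → x ⊗ 𝟙 ≡ x
  ⊗-identityʳ x = emb-cancel (trans (emb-⊗ _ _) (trans (*-congˡ emb-𝟙) (*-identityʳ _)))

  ⊖-𝟘 : ⊖ 𝟘 ≡ 𝟘
  ⊖-𝟘 = emb-cancel (trans (emb-⊖ _) (trans (-‿cong emb-𝟘) (trans (solve 0 (:- con (+ 0) := con (+ 0)) refl) (sym emb-𝟘))))

  ⊖-cancelʳ : ∀ x y → (x ⊕ (⊖ y)) ⊕ y ≡ x
  ⊖-cancelʳ x y = emb-cancel (trans (emb-⊕ _ _) (trans (+-congʳ (trans (emb-⊕ _ _) (+-congˡ (emb-⊖ _))))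
                    (solve 2 (λ a b → (a :- b) :+ b := a) refl _ _)))

  ⊕-cancelʳ : ∀ x y → (x ⊕ y) ⊕ (⊖ y) ≡ x
  ⊕-cancelʳ x y = emb-cancel (trans (emb-⊕ _ _) (trans (+-cong (emb-⊕ _ _) (emb-⊖ _))
                    (solve 2 (λ a b → (a :+ b) :- b := a) refl _ _)))

  reflect-involutive : ∀ p x → p ⊕ (⊖ (p ⊕ (⊖ x))) ≡ x
  reflect-involutive p x = emb-cancel (trans (emb-⊕ _ _) (trans (+-congˡ (trans (emb-⊖ _) (-‿cong (trans (emb-⊕ _ _) (+-congˡ (emb-⊖ _))))))
                             (solve 2 (λ a b → a :+ :- (a :- b) := b) refl _ _)))

  translation : Fin r → Permutation′ r
  translation p = permutation (_⊕ p) (_⊕ (⊖ p)) (λ x → ⊖-cancelʳ x p) (λ x → ⊕-cancelʳ x p)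

  reflection : Fin r → Permutation′ r
  reflection p = permutation (λ x → p ⊕ (⊖ x)) (λ x → p ⊕ (⊖ x)) (reflect-involutive p) (reflect-involutive p)

module FiniteSubfieldProperties {c ℓ} (R : CommutativeRing c ℓ) (ID : IsIntegralDomain R) {r : ℕ} (F : FiniteSubfield R r) where
  open CommutativeRing R hiding (zero)
  open IsIntegralDomain ID
  open FiniteSubfield F
  open IntegralDomainProperties R ID
  open SubfieldArithmetic F
  open RingSum R
  open import Relation.Binary.Reasoning.Setoid setoid

  𝟘≢𝟙 : 𝟘 ≢ 𝟙
  𝟘≢𝟙 𝟘≡𝟙 = 1≉0 (trans (sym emb-𝟙) (trans (reflexive (≡.cong emb (≡.sym 𝟘≡𝟙))) emb-𝟘))

  emb-≉0 : ∀ {x} → x ≢ 𝟘 → ¬ emb x ≈ 0#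
  emb-≉0 x≢𝟘 x≈0 = x≢𝟘 (emb-cancel (trans x≈0 (sym emb-𝟘)))

  ⊗-≢𝟘 : ∀ {x y} → x ≢ 𝟘 → y ≢ 𝟘 → x ⊗ y ≢ 𝟘
  ⊗-≢𝟘 x≢𝟘 y≢𝟘 xy≡𝟘 = *-≉0 (emb-≉0 x≢𝟘) (emb-≉0 y≢𝟘) (trans (sym (emb-⊗ _ _)) (trans (reflexive (≡.cong emb xy≡𝟘)) emb-𝟘))

  ⊗-cancelˡ : ∀ {x} → x ≢ 𝟘 → ∀ {y z} → x ⊗ y ≡ x ⊗ z → y ≡ z
  ⊗-cancelˡ x≢𝟘 {y} {z} xy≡xz =
    emb-cancel (*-cancelˡ (emb-≉0 x≢𝟘) (trans (sym (emb-⊗ _ y)) (trans (reflexive (≡.cong emb xy≡xz)) (emb-⊗ _ z))))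

  recip : Fin r → Fin r
  recip x with Fin.any? (λ y → x ⊗ y Fin.≟ 𝟙)
  ... | yes (y , _) = y
  ... | no _ = 𝟘

  ⊗-recip : ∀ {x} → x ≢ 𝟘 → x ⊗ recip x ≡ 𝟙
  ⊗-recip {x} x≢𝟘 with Fin.any? (λ y → x ⊗ y Fin.≟ 𝟙)
  ... | yes (_ , xy≡𝟙) = xy≡𝟙
  ... | no ∄y = ⊥-elim (∄y (injective⇒surjective (x ⊗_) (⊗-cancelˡ x≢𝟘) 𝟙))

  recip-𝟘 : recip 𝟘 ≡ 𝟘
  recip-𝟘 with Fin.any? (λ y → 𝟘 ⊗ y Fin.≟ 𝟙)
  ... | yes (y , 𝟘y≡𝟙) = ⊥-elim (𝟘≢𝟙 (≡.trans (≡.sym (⊗-zeroˡ y)) 𝟘y≡𝟙))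
  ... | no _ = ≡.refl

  *-recip : ∀ {x} → x ≢ 𝟘 → emb x * emb (recip x) ≈ 1#
  *-recip x≢𝟘 = trans (sym (emb-⊗ _ _)) (trans (reflexive (≡.cong emb (⊗-recip x≢𝟘))) emb-𝟙)

  recip-≢𝟘 : ∀ {x} → x ≢ 𝟘 → recip x ≢ 𝟘
  recip-≢𝟘 x≢𝟘 x⁻¹≡𝟘 = 𝟘≢𝟙 (≡.trans (≡.sym (⊗-zeroʳ _)) (≡.trans (≡.cong (_ ⊗_) (≡.sym x⁻¹≡𝟘)) (⊗-recip x≢𝟘)))

  recip-involutive : ∀ x → recip (recip x) ≡ x
  recip-involutive x with x Fin.≟ 𝟘
  ... | yes ≡.refl = ≡.trans (≡.cong recip recip-𝟘) recip-𝟘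
  ... | no x≢𝟘 = ⊗-cancelˡ (recip-≢𝟘 x≢𝟘) (≡.trans (⊗-recip (recip-≢𝟘 x≢𝟘)) (≡.sym (≡.trans (⊗-comm _ _) (⊗-recip x≢𝟘))))

  recip-permutation : Permutation′ r
  recip-permutation = permutation recip recip recip-involutive recip-involutive

  scale : ∀ {c} → c ≢ 𝟘 → Permutation′ r
  scale {c} c≢𝟘 = permutation (c ⊗_) (recip c ⊗_) (cancel c (recip c) (⊗-recip c≢𝟘))
                                                  (cancel (recip c) c (≡.trans (⊗-comm _ _) (⊗-recip c≢𝟘)))
    where
    cancel : ∀ a b → a ⊗ b ≡ 𝟙 → ∀ x → a ⊗ (b ⊗ x) ≡ x
    cancel a b ab≡𝟙 x = emb-cancel (begin
      emb (a ⊗ (b ⊗ x))          ≈⟨ trans (emb-⊗ _ _) (*-congˡ (emb-⊗ _ _)) ⟩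
      emb a * (emb b * emb x)    ≈⟨ *-assoc _ _ _ ⟨
      (emb a * emb b) * emb x    ≈⟨ *-congʳ (trans (sym (emb-⊗ a b)) (trans (reflexive (≡.cong emb ab≡𝟙)) emb-𝟙)) ⟩
      1# * emb x                 ≈⟨ *-identityˡ _ ⟩
      emb x                      ∎)

  ∑-allFin-scale : ∀ {c} → c ≢ 𝟘 → ∀ f → ∑ (allFin r) (λ x → f (c ⊗ x)) ≈ ∑ (allFin r) f
  ∑-allFin-scale c≢𝟘 = ∑-allFin-permute (scale c≢𝟘)

  units : List (Fin r)
  units = allFinExcept 𝟘

  units-≢𝟘 : All (_≢ 𝟘) units
  units-≢𝟘 = All.all-filter (λ x → ¬? (x Fin.≟ 𝟘)) (allFin r)

  ∑-units-cong : ∀ {f g} → (∀ {x} → x ≢ 𝟘 → f x ≈ g x) → ∑ units f ≈ ∑ units g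
  ∑-units-cong f≈g = ∑-cong-All (All.map f≈g units-≢𝟘)

  module _ {c′ ℓ′} (M : CommutativeMonoid c′ ℓ′) where
    open CommutativeMonoid M using () renaming (Carrier to M₀; _≈_ to _≈ᴹ_)
    open ListSum M using () renaming (∑ to ∑ᴹ)

    ∑-units-scale : ∀ {c} → c ≢ 𝟘 → ∀ (f : Fin r → M₀) → ∑ᴹ units (λ x → f (c ⊗ x)) ≈ᴹ ∑ᴹ units f
    ∑-units-scale {c} c≢𝟘 f = ListSum.∑-allFinExcept-permute M (scale c≢𝟘) 𝟘 f cx≡𝟘⇒x≡𝟘 (⊗-zeroʳ c)
      where
      cx≡𝟘⇒x≡𝟘 : ∀ x → c ⊗ x ≡ 𝟘 → x ≡ 𝟘
      cx≡𝟘⇒x≡𝟘 x cx≡𝟘 with x Fin.≟ 𝟘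
      ... | yes x≡𝟘 = x≡𝟘
      ... | no x≢𝟘 = ⊥-elim (⊗-≢𝟘 c≢𝟘 x≢𝟘 cx≡𝟘)

  ∑-units-recip : ∀ f → ∑ units (λ x → f (recip x)) ≈ ∑ units f
  ∑-units-recip f = ∑-allFinExcept-permute recip-permutation 𝟘 f x⁻¹≡𝟘⇒x≡𝟘 recip-𝟘
    where
    x⁻¹≡𝟘⇒x≡𝟘 : ∀ x → recip x ≡ 𝟘 → x ≡ 𝟘
    x⁻¹≡𝟘⇒x≡𝟘 x x⁻¹≡𝟘 = ≡.trans (≡.sym (recip-involutive x)) (≡.trans (≡.cong recip x⁻¹≡𝟘) recip-𝟘)

  2≤r : 2 ℕ.≤ r
  2≤r = Fin.injective⇒≤ {f = pair} pair-injective
    where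
    pair : Fin 2 → Fin r
    pair Fin.zero = 𝟘
    pair (Fin.suc _) = 𝟙
    pair-injective : ∀ {i j} → pair i ≡ pair j → i ≡ j
    pair-injective {Fin.zero} {Fin.zero} _ = ≡.refl
    pair-injective {Fin.zero} {Fin.suc Fin.zero} 𝟘≡𝟙 = ⊥-elim (𝟘≢𝟙 𝟘≡𝟙)
    pair-injective {Fin.suc Fin.zero} {Fin.zero} 𝟙≡𝟘 = ⊥-elim (𝟘≢𝟙 (≡.sym 𝟙≡𝟘))
    pair-injective {Fin.suc Fin.zero} {Fin.suc Fin.zero} _ = ≡.refl

  length-units : length units ≡ r ∸ 1
  length-units = ≡.sym (≡.cong (_∸ 1) r≡1+|units|)
    where
    module ℕSum = ListSum ℕ.+-0-commutativeMonoid
    ∑-ones : ∀ (xs : List (Fin r)) → ℕSum.∑ xs (λ _ → 1) ≡ length xs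
    ∑-ones [] = ≡.refl
    ∑-ones (_ ∷ xs) = ≡.cong suc (∑-ones xs)
    r≡1+|units| : r ≡ suc (length units)
    r≡1+|units| = ≡.trans (≡.sym (length-allFin r)) (≡.trans (≡.sym (∑-ones (allFin r)))
                    (≡.trans (ℕSum.∑-allFin-extract 𝟘 (λ _ → 1)) (≡.cong suc (∑-ones units))))

module PowerSums {c ℓ} (R : CommutativeRing c ℓ) (ID : IsIntegralDomain R) {r : ℕ} (F : FiniteSubfield R r) where
  open CommutativeRing R hiding (zero)
  open IsIntegralDomain ID
  open FiniteSubfield F
  open IntegerCoefficientSolver R
  open IntegralDomainProperties R ID
  open SubfieldArithmetic F
  open FiniteSubfieldProperties R ID F
  open RingSum R
  open RingPowers R
  open import Data.Product using (_×_)
  open import Algebra.Definitions.RawSemiring (Semiring.rawSemiring semiring) using (_^_)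
  open import Algebra.Properties.Semiring.Exp semiring using (^-congˡ; ^-homo-*)
  open import Algebra.Properties.CommutativeSemiring.Exp commutativeSemiring using (^-distrib-*)
  open import Algebra.Properties.Monoid.Mult +-monoid using () renaming (_×_ to _×ᴷ_)
  open import Relation.Binary.Reasoning.Setoid setoid

  r×1≈0 : r ×ᴷ 1# ≈ 0#
  r×1≈0 = identityʳ-unique (∑ (allFin r) emb) (r ×ᴷ 1#) (begin
    ∑ (allFin r) emb + r ×ᴷ 1#
      ≈⟨ +-congˡ (trans (∑-const (allFin r) 1#) (reflexive (≡.cong (_×ᴷ 1#) (length-allFin r)))) ⟨
    ∑ (allFin r) emb + ∑ (allFin r) (λ _ → 1#)
      ≈⟨ ∑-distrib-∙ (allFin r) emb (λ _ → 1#) ⟨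
    ∑ (allFin r) (λ x → emb x + 1#)
      ≈⟨ ∑-cong (allFin r) (λ x → trans (+-congˡ (sym emb-𝟙)) (sym (emb-⊕ x 𝟙))) ⟩
    ∑ (allFin r) (λ x → emb (x ⊕ 𝟙))
      ≈⟨ ∑-allFin-permute (translation 𝟙) emb ⟩
    ∑ (allFin r) emb ∎)
    where open import Algebra.Properties.Group +-group using (identityʳ-unique)

  ∑-units-one : ∑ units (λ _ → 1#) ≈ - 1#
  ∑-units-one = inverseʳ-unique 1# _ (begin
    1# + ∑ units (λ _ → 1#)   ≈⟨ ∑-allFin-extract 𝟘 (λ _ → 1#) ⟨
    ∑ (allFin r) (λ _ → 1#)   ≈⟨ ∑-const (allFin r) 1# ⟩
    length (allFin r) ×ᴷ 1#   ≡⟨ ≡.cong (_×ᴷ 1#) (length-allFin r) ⟩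
    r ×ᴷ 1#                   ≈⟨ r×1≈0 ⟩
    0#                        ∎)
    where open import Algebra.Properties.Group +-group using (inverseʳ-unique)

  fermat : ∀ {x} → x ≢ 𝟘 → emb x ^ (r ∸ 1) ≈ 1#
  fermat {x} x≢𝟘 = *-cancelˡ (∏≉0 units-≢𝟘) (begin
    P * emb x ^ (r ∸ 1)                 ≈⟨ *-comm _ _ ⟩
    emb x ^ (r ∸ 1) * P                 ≡⟨ ≡.cong (λ n → emb x ^ n * P) length-units ⟨
    emb x ^ length units * P            ≈⟨ *-congʳ (∏.∑-const units (emb x)) ⟨
    ∏.∑ units (λ _ → emb x) * P         ≈⟨ ∏.∑-distrib-∙ units _ emb ⟨
    ∏.∑ units (λ y → emb x * emb y)     ≈⟨ ∏.∑-cong units (λ y → sym (emb-⊗ x y)) ⟩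
    ∏.∑ units (λ y → emb (x ⊗ y))       ≈⟨ ∑-units-scale *-commutativeMonoid x≢𝟘 emb ⟩
    P                                   ≈⟨ *-identityʳ P ⟨
    P * 1#                              ∎)
    where
    module ∏ = ListSum *-commutativeMonoid
    P = ∏.∑ units emb
    ∏≉0 : ∀ {xs} → All (_≢ 𝟘) xs → ¬ ∏.∑ xs emb ≈ 0#
    ∏≉0 [] = 1≉0
    ∏≉0 (x≢𝟘 ∷ xs≢𝟘) = *-≉0 (emb-≉0 x≢𝟘) (∏≉0 xs≢𝟘)

  -1^j≈1 : ∀ {j} → (r ∸ 1) ∣ j → (- 1#) ^ j ≈ 1#
  -1^j≈1 {j} r-1∣j = trans (^-congˡ j (sym -𝟙≈-1)) (^-∣ (r ∸ 1) (fermat ⊖𝟙≢𝟘) r-1∣j)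
    where
    -𝟙≈-1 : emb (⊖ 𝟙) ≈ - 1#
    -𝟙≈-1 = trans (emb-⊖ 𝟙) (-‿cong emb-𝟙)
    ⊖𝟙≢𝟘 : ⊖ 𝟙 ≢ 𝟘
    ⊖𝟙≢𝟘 ⊖𝟙≡𝟘 = 1≉0 (begin
      1#          ≈⟨ solve 1 (λ a → a := :- (:- a)) refl 1# ⟩
      - (- 1#)    ≈⟨ -‿cong (trans (sym -𝟙≈-1) (trans (reflexive (≡.cong emb ⊖𝟙≡𝟘)) emb-𝟘)) ⟩
      - 0#        ≈⟨ solve 0 (:- con (+ 0) := con (+ 0)) refl ⟩
      0#          ∎)

  powerSum : ℕ → Carrier
  powerSum j = ∑ units (λ x → emb x ^ j)

  powerSum-divisible : ∀ {j} → (r ∸ 1) ∣ j → powerSum j ≈ - 1#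
  powerSum-divisible r-1∣j = trans (∑-units-cong (λ x≢𝟘 → ^-∣ (r ∸ 1) (fermat x≢𝟘) r-1∣j)) ∑-units-one

  powerSum-scale : ∀ {x} j → x ≢ 𝟘 → powerSum j ≈ emb x ^ j * powerSum j
  powerSum-scale {x} j x≢𝟘 = begin
    ∑ units (λ y → emb y ^ j)                ≈⟨ ∑-units-scale +-commutativeMonoid x≢𝟘 (λ y → emb y ^ j) ⟨
    ∑ units (λ y → emb (x ⊗ y) ^ j)          ≈⟨ ∑-cong units (λ y → trans (^-congˡ j (emb-⊗ x y)) (^-distrib-* _ _ j)) ⟩
    ∑ units (λ y → emb x ^ j * emb y ^ j)    ≈⟨ *-distribˡ-∑ (emb x ^ j) units _ ⟨
    emb x ^ j * ∑ units (λ y → emb y ^ j)    ∎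

  -- Otherwise X^(g+1) − X, of degree g + 1 < r, would vanish on all of F.
  units-not-all-roots : ∀ {g} → 0 ℕ.< g → g ℕ.< r ∸ 1 → ¬ (∀ {x} → x ≢ 𝟘 → emb x ^ g ≈ 1#)
  units-not-all-roots {suc g} _ g<r-1 all-roots = monomial-≉0 g (drop-two (many-roots⇒zero points P |P|≤r distinct vanishes))
    where
    P = 0# ∷ - 1# ∷ monomial g
    points = List.map emb (allFin r)
    drop-two : IsZero P → IsZero (monomial g)
    drop-two (_ ∷ _ ∷ z) = z
    |P|≤r : length P ℕ.≤ length points
    |P|≤r = ℕ.≤-trans (ℕ.≤-reflexive (≡.cong (2 ℕ.+_) (length-monomial g))) (ℕ.≤-trans (ℕ.s≤s g<r-1) (ℕ.≤-reflexive
              (≡.trans (ℕ.m+[n∸m]≡n (ℕ.≤-trans (ℕ.s≤s ℕ.z≤n) 2≤r)) (≡.sym (≡.trans (List.length-map emb (allFin r)) (length-allFin r))))))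
    distinct : AllPairs (λ a b → ¬ a ≈ b) points
    distinct = AllPairs.map⁺ (AllPairs.map (λ x≢y x≈y → x≢y (emb-cancel x≈y)) (Unique.allFin⁺ r))
    vanishes : All (λ a → eval P a ≈ 0#) points
    vanishes = All.map⁺ (All.tabulate⁺ root)
      where
      root : ∀ y → eval P (emb y) ≈ 0#
      root y with y Fin.≟ 𝟘
      ... | yes ≡.refl = trans (+-congˡ (trans (*-congʳ emb-𝟘) (zeroˡ _))) (+-identityʳ 0#)
      ... | no y≢𝟘 = begin
        0# + emb y * (- 1# + emb y * eval (monomial g) (emb y))
          ≈⟨ +-congˡ (*-congˡ (+-congˡ (*-congˡ (eval-monomial g (emb y))))) ⟩
        0# + emb y * (- 1# + emb y ^ suc g)
          ≈⟨ +-congˡ (*-congˡ (+-congˡ (all-roots y≢𝟘))) ⟩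
        0# + emb y * (- 1# + 1#)
          ≈⟨ solve 1 (λ a → con (+ 0) :+ a :* (:- con (+ 1) :+ con (+ 1)) := con (+ 0)) refl _ ⟩
        0# ∎

  _^ᶠ_ : Fin r → ℕ → Fin r
  x ^ᶠ zero = 𝟙
  x ^ᶠ suc n = x ⊗ (x ^ᶠ n)

  emb-^ᶠ : ∀ x n → emb (x ^ᶠ n) ≈ emb x ^ n
  emb-^ᶠ x zero = emb-𝟙
  emb-^ᶠ x (suc n) = trans (emb-⊗ x _) (*-congˡ (emb-^ᶠ x n))

  non-root-unit : ∀ {j} → ¬ (r ∸ 1) ∣ j → ∃ λ x → x ≢ 𝟘 × ¬ emb x ^ j ≈ 1#
  non-root-unit {j} r-1∤j with Fin.any? (λ x → ¬? (x Fin.≟ 𝟘) ×-dec ¬? (x ^ᶠ j Fin.≟ 𝟙))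
  ... | yes (x , x≢𝟘 , xʲ≢𝟙) = x , x≢𝟘 , λ xʲ≈1 → xʲ≢𝟙 (emb-cancel (trans (emb-^ᶠ x j) (trans xʲ≈1 (sym emb-𝟙))))
  ... | no ∄x = ⊥-elim (units-not-all-roots 0<g (m%n<n j (r ∸ 1)) x^g≈1)
    where
    instance
      r-1≢0 : ℕ.NonZero (r ∸ 1)
      r-1≢0 = ℕ.>-nonZero (ℕ.∸-monoˡ-≤ 1 2≤r)
    g = j % (r ∸ 1)
    0<g : 0 ℕ.< g
    0<g = ℕ.n≢0⇒n>0 (λ g≡0 → r-1∤j (m%n≡0⇒n∣m j (r ∸ 1) g≡0))
    x^j≈1 : ∀ {x} → x ≢ 𝟘 → emb x ^ j ≈ 1#
    x^j≈1 {x} x≢𝟘 with x ^ᶠ j Fin.≟ 𝟙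
    ... | yes xʲ≡𝟙 = trans (sym (emb-^ᶠ x j)) (trans (reflexive (≡.cong emb xʲ≡𝟙)) emb-𝟙)
    ... | no xʲ≢𝟙 = ⊥-elim (∄x (x , x≢𝟘 , xʲ≢𝟙))
    x^g≈1 : ∀ {x} → x ≢ 𝟘 → emb x ^ g ≈ 1#
    x^g≈1 {x} x≢𝟘 = begin
      emb x ^ g                              ≈⟨ *-identityʳ _ ⟨
      emb x ^ g * 1#                         ≈⟨ *-congˡ (^-∣ (r ∸ 1) (fermat x≢𝟘) (divides (j / (r ∸ 1)) ≡.refl)) ⟨
      emb x ^ g * emb x ^ (j / (r ∸ 1) ℕ.* (r ∸ 1)) ≈⟨ ^-homo-* _ g _ ⟨
      emb x ^ (g ℕ.+ j / (r ∸ 1) ℕ.* (r ∸ 1))      ≡⟨ ≡.cong (emb x ^_) (m≡m%n+[m/n]*n j (r ∸ 1)) ⟨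
      emb x ^ j                              ≈⟨ x^j≈1 x≢𝟘 ⟩
      1#                                     ∎

  powerSum-indivisible : ∀ {j} → ¬ (r ∸ 1) ∣ j → powerSum j ≈ 0#
  powerSum-indivisible {j} r-1∤j with non-root-unit r-1∤j
  ... | x , x≢𝟘 , xʲ≉1 = x≈cx⇒x≈0 xʲ≉1 (powerSum-scale j x≢𝟘)

module CoefficientVectors {c ℓ} {R : CommutativeRing c ℓ} {r : ℕ} (F : FiniteSubfield R r) (d₀ : ℕ) where
  open FiniteSubfield F
  open Setting R F d₀ using (Poly; _+ₚ_; _·ₚ_; monicCoeff; monicPoly)
  open SubfieldArithmetic F

  Coeffs : ℕ → Set
  Coeffs e = Vec (Fin r) e

  coeff : ∀ {e} → Coeffs e → ℕ → Fin r
  coeff [] _ = 𝟘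
  coeff (x ∷ v) zero = x
  coeff (x ∷ v) (suc n) = coeff v n

  coeff-injective : ∀ {e} {u v : Coeffs e} → (∀ n → coeff u n ≡ coeff v n) → u ≡ v
  coeff-injective {u = []} {[]} _ = ≡.refl
  coeff-injective {u = x ∷ u} {y ∷ v} u≗v = ≡.cong₂ _∷_ (u≗v 0) (coeff-injective (u≗v ∘ suc))

  coeff-≥ : ∀ {e} (v : Coeffs e) {n} → e ℕ.≤ n → coeff v n ≡ 𝟘
  coeff-≥ [] _ = ≡.refl
  coeff-≥ (x ∷ v) (ℕ.s≤s e≤n) = coeff-≥ v e≤n

  coeff-lookup : ∀ {e} (v : Coeffs e) {n} (n<e : n ℕ.< e) → coeff v n ≡ lookup v (Fin.fromℕ< n<e)
  coeff-lookup (x ∷ v) {zero} _ = ≡.refl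
  coeff-lookup (x ∷ v) {suc n} (ℕ.s≤s n<e) = coeff-lookup v n<e

  coeff-tabulate : ∀ {m} (g : ℕ → Fin r) → (∀ {n} → m ℕ.≤ n → g n ≡ 𝟘) →
                   ∀ n → coeff (tabulate {n = m} (g ∘ Fin.toℕ)) n ≡ g n
  coeff-tabulate {zero} g g≥≡𝟘 n = ≡.sym (g≥≡𝟘 ℕ.z≤n)
  coeff-tabulate {suc m} g g≥≡𝟘 zero = ≡.refl
  coeff-tabulate {suc m} g g≥≡𝟘 (suc n) = coeff-tabulate (g ∘ suc) (g≥≡𝟘 ∘ ℕ.s≤s) n

  coeff-zipWith : ∀ {e} (f : Fin r → Fin r → Fin r) → f 𝟘 𝟘 ≡ 𝟘 → (u v : Coeffs e) →
                  ∀ n → coeff (zipWith f u v) n ≡ f (coeff u n) (coeff v n)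
  coeff-zipWith f f𝟘𝟘≡𝟘 [] [] n = ≡.sym f𝟘𝟘≡𝟘
  coeff-zipWith f f𝟘𝟘≡𝟘 (x ∷ u) (y ∷ v) zero = ≡.refl
  coeff-zipWith f f𝟘𝟘≡𝟘 (x ∷ u) (y ∷ v) (suc n) = coeff-zipWith f f𝟘𝟘≡𝟘 u v n

  coeff-map : ∀ {e} (f : Fin r → Fin r) → f 𝟘 ≡ 𝟘 → (u : Coeffs e) → ∀ n → coeff (Vec.map f u) n ≡ f (coeff u n)
  coeff-map f f𝟘≡𝟘 [] n = ≡.sym f𝟘≡𝟘
  coeff-map f f𝟘≡𝟘 (x ∷ u) zero = ≡.refl
  coeff-map f f𝟘≡𝟘 (x ∷ u) (suc n) = coeff-map f f𝟘≡𝟘 u n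

  -- The coefficients of v + x θ^e; written with if/does so that the step from (suc n, suc e)
  -- to (n, e) is definitional (coeff-∷ʳ relies on it).
  leading : ∀ e → Coeffs e → Fin r → ℕ → Fin r
  leading e v x n = if does (n ℕ.≟ e) then x else coeff v n

  leading-≡ : ∀ {e} (v : Coeffs e) x {n} → n ≡ e → leading e v x n ≡ x
  leading-≡ v x {n} n≡e = ≡.cong (if_then x else coeff v n) (dec-true (n ℕ.≟ _) n≡e)

  leading-≢ : ∀ {e} (v : Coeffs e) x {n} → n ≢ e → leading e v x n ≡ coeff v n
  leading-≢ v x {n} n≢e = ≡.cong (if_then x else coeff v n) (dec-false (n ℕ.≟ _) n≢e)

  leading-> : ∀ {e} (v : Coeffs e) x {n} → e ℕ.< n → leading e v x n ≡ 𝟘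
  leading-> v x e<n = ≡.trans (leading-≢ v x (λ n≡e → ℕ.<-irrefl (≡.sym n≡e) e<n)) (coeff-≥ v (ℕ.<⇒≤ e<n))

  coeff-∷ʳ : ∀ {e} (v : Coeffs e) x n → coeff (v ∷ʳ x) n ≡ leading e v x n
  coeff-∷ʳ [] x zero = ≡.refl
  coeff-∷ʳ [] x (suc n) = ≡.refl
  coeff-∷ʳ (y ∷ v) x zero = ≡.refl
  coeff-∷ʳ (y ∷ v) x (suc n) = coeff-∷ʳ v x n

  coeff-monicPoly : ∀ e (e<d₀ : e ℕ.< d₀) cs n → coeff (monicPoly e e<d₀ cs) n ≡ leading e cs 𝟙 n
  coeff-monicPoly e e<d₀ cs n = ≡.trans (≡.cong (λ v → coeff v n) (Vec.tabulate-cong monicCoeff≗leading))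
                                        (coeff-tabulate (leading e cs 𝟙) (λ d₀≤n → leading-> cs 𝟙 (ℕ.<-≤-trans e<d₀ d₀≤n)) n)
    where
    monicCoeff≗leading : ∀ i → monicCoeff e cs i ≡ leading e cs 𝟙 (Fin.toℕ i)
    monicCoeff≗leading i with Fin.toℕ i ℕ.<? e
    ... | yes i<e = ≡.trans (≡.sym (coeff-lookup cs i<e)) (≡.sym (leading-≢ cs 𝟙 (λ i≡e → ℕ.<-irrefl i≡e i<e)))
    ... | no i≮e with Fin.toℕ i ℕ.≟ e
    ...   | yes i≡e = ≡.sym (leading-≡ cs 𝟙 i≡e)
    ...   | no i≢e = ≡.sym (≡.trans (leading-≢ cs 𝟙 i≢e) (coeff-≥ cs (ℕ.≮⇒≥ i≮e)))

  embed : ∀ {e} → Coeffs e → Poly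
  embed u = tabulate (coeff u ∘ Fin.toℕ)

  coeff-embed : ∀ {e} → e ℕ.≤ d₀ → (u : Coeffs e) → ∀ n → coeff (embed u) n ≡ coeff u n
  coeff-embed e≤d₀ u = coeff-tabulate (coeff u) (λ d₀≤n → coeff-≥ u (ℕ.≤-trans e≤d₀ d₀≤n))

  leadingVec : ∀ d e → Coeffs e → Fin r → Coeffs d
  leadingVec d e v x = tabulate (leading e v x ∘ Fin.toℕ)

  coeff-leadingVec : ∀ {d e} → e ℕ.< d → (v : Coeffs e) (x : Fin r) → ∀ n → coeff (leadingVec d e v x) n ≡ leading e v x n
  coeff-leadingVec e<d v x = coeff-tabulate (leading _ v x) (λ d≤n → leading-> v x (ℕ.<-≤-trans e<d d≤n))

  0ᵥ : ∀ {e} → Coeffs e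
  0ᵥ = replicate _ 𝟘

  _-ᵥ_ : ∀ {e} → Coeffs e → Coeffs e → Coeffs e
  a -ᵥ u = zipWith (λ x y → x ⊕ (⊖ y)) a u

  _·ᵥ_ : ∀ {e} → Fin r → Coeffs e → Coeffs e
  ε ·ᵥ cs = zipWith _⊗_ (replicate _ ε) cs

  private
    coeff-0ᵥ : ∀ {e} n → coeff (0ᵥ {e}) n ≡ 𝟘
    coeff-0ᵥ {zero} n = ≡.refl
    coeff-0ᵥ {suc e} zero = ≡.refl
    coeff-0ᵥ {suc e} (suc n) = coeff-0ᵥ {e} n

    coeff-·ᵥ : ∀ {e} ε (cs : Coeffs e) n → coeff (ε ·ᵥ cs) n ≡ ε ⊗ coeff cs n
    coeff-·ᵥ ε [] n = ≡.sym (⊗-zeroʳ ε)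
    coeff-·ᵥ ε (x ∷ cs) zero = ≡.refl
    coeff-·ᵥ ε (x ∷ cs) (suc n) = coeff-·ᵥ ε cs n

    coeff-+ₚ : ∀ a b n → coeff (a +ₚ b) n ≡ coeff a n ⊕ coeff b n
    coeff-+ₚ = coeff-zipWith _⊕_ (⊕-identityʳ 𝟘)

    coeff-·ₚ : ∀ ε a n → coeff (ε ·ₚ a) n ≡ ε ⊗ coeff a n
    coeff-·ₚ ε = coeff-map (ε ⊗_) (⊗-zeroʳ ε)

    coeff-difference : ∀ {e} (a u : Coeffs e) n → coeff (a -ᵥ u) n ≡ coeff a n ⊕ (⊖ coeff u n)
    coeff-difference = coeff-zipWith _ (≡.trans (≡.cong (𝟘 ⊕_) ⊖-𝟘) (⊕-identityʳ 𝟘))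

  monicPoly-split : ∀ {d} (d<d₀ : d ℕ.< d₀) (a u : Coeffs d) → monicPoly d d<d₀ a ≡ monicPoly d d<d₀ (a -ᵥ u) +ₚ embed u
  monicPoly-split {d} d<d₀ a u = coeff-injective λ n → begin
    coeff (monicPoly d d<d₀ a) n
      ≡⟨ coeff-monicPoly d d<d₀ a n ⟩
    leading d a 𝟙 n
      ≡⟨ split n ⟩
    leading d (a -ᵥ u) 𝟙 n ⊕ coeff u n
      ≡⟨ ≡.cong₂ _⊕_ (coeff-monicPoly d d<d₀ (a -ᵥ u) n) (coeff-embed (ℕ.<⇒≤ d<d₀) u n) ⟨
    coeff (monicPoly d d<d₀ (a -ᵥ u)) n ⊕ coeff (embed u) n
      ≡⟨ coeff-+ₚ (monicPoly d d<d₀ (a -ᵥ u)) (embed u) n ⟨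
    coeff (monicPoly d d<d₀ (a -ᵥ u) +ₚ embed u) n ∎
    where
    open ≡.≡-Reasoning
    split : ∀ n → leading d a 𝟙 n ≡ leading d (a -ᵥ u) 𝟙 n ⊕ coeff u n
    split n with n ℕ.≟ d
    ... | yes n≡d = begin
      leading d a 𝟙 n                      ≡⟨ leading-≡ a 𝟙 n≡d ⟩
      𝟙                                    ≡⟨ ⊕-identityʳ 𝟙 ⟨
      𝟙 ⊕ 𝟘                                ≡⟨ ≡.cong₂ _⊕_ (leading-≡ (a -ᵥ u) 𝟙 n≡d) (coeff-≥ u (ℕ.≤-reflexive (≡.sym n≡d))) ⟨
      leading d (a -ᵥ u) 𝟙 n ⊕ coeff u n   ∎
    ... | no n≢d = begin
      leading d a 𝟙 n                               ≡⟨ leading-≢ a 𝟙 n≢d ⟩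
      coeff a n                                     ≡⟨ ⊖-cancelʳ (coeff a n) (coeff u n) ⟨
      (coeff a n ⊕ (⊖ coeff u n)) ⊕ coeff u n        ≡⟨ ≡.cong (_⊕ coeff u n) (≡.trans (leading-≢ (a -ᵥ u) 𝟙 n≢d) (coeff-difference a u n)) ⟨
      leading d (a -ᵥ u) 𝟙 n ⊕ coeff u n            ∎

  embed-leadingVec : ∀ {d e} → e ℕ.< d → d ℕ.≤ d₀ → (e<d₀ : e ℕ.< d₀) (ε : Fin r) (cs : Coeffs e) →
                     embed (leadingVec d e (ε ·ᵥ cs) ε) ≡ ε ·ₚ monicPoly e e<d₀ cs
  embed-leadingVec {d} {e} e<d d≤d₀ e<d₀ ε cs = coeff-injective λ n → begin
    coeff (embed (leadingVec d e (ε ·ᵥ cs) ε)) n   ≡⟨ coeff-embed d≤d₀ (leadingVec d e (ε ·ᵥ cs) ε) n ⟩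
    coeff (leadingVec d e (ε ·ᵥ cs) ε) n           ≡⟨ coeff-leadingVec e<d (ε ·ᵥ cs) ε n ⟩
    leading e (ε ·ᵥ cs) ε n                        ≡⟨ scale n ⟩
    ε ⊗ leading e cs 𝟙 n                           ≡⟨ ≡.cong (ε ⊗_) (coeff-monicPoly e e<d₀ cs n) ⟨
    ε ⊗ coeff (monicPoly e e<d₀ cs) n              ≡⟨ coeff-·ₚ ε (monicPoly e e<d₀ cs) n ⟨
    coeff (ε ·ₚ monicPoly e e<d₀ cs) n             ∎
    where
    open ≡.≡-Reasoning
    scale : ∀ n → leading e (ε ·ᵥ cs) ε n ≡ ε ⊗ leading e cs 𝟙 n
    scale n with n ℕ.≟ e
    ... | yes n≡e = ≡.trans (leading-≡ (ε ·ᵥ cs) ε n≡e) (≡.sym (≡.trans (≡.cong (ε ⊗_) (leading-≡ cs 𝟙 n≡e)) (⊗-identityʳ ε)))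
    ... | no n≢e = ≡.trans (leading-≢ (ε ·ᵥ cs) ε n≢e) (≡.trans (coeff-·ᵥ ε cs n) (≡.sym (≡.cong (ε ⊗_) (leading-≢ cs 𝟙 n≢e))))

  -ᵥ-identityʳ : ∀ {d} (a : Coeffs d) → a -ᵥ 0ᵥ ≡ a
  -ᵥ-identityʳ {d} a = coeff-injective λ n → ≡.trans (coeff-difference a 0ᵥ n) (≡.trans (≡.cong (λ z → coeff a n ⊕ (⊖ z)) (coeff-0ᵥ {d} n))
                                                   (≡.trans (≡.cong (coeff a n ⊕_) ⊖-𝟘) (⊕-identityʳ _)))

  0ᵥ-∷ʳ : ∀ d → 0ᵥ {d} ∷ʳ 𝟘 ≡ 0ᵥ
  0ᵥ-∷ʳ zero = ≡.refl
  0ᵥ-∷ʳ (suc d) = ≡.cong (𝟘 ∷_) (0ᵥ-∷ʳ d)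

  leadingVec-∷ʳ-𝟘 : ∀ {d e} → e ℕ.< d → (v : Coeffs e) (ε : Fin r) → leadingVec d e v ε ∷ʳ 𝟘 ≡ leadingVec (suc d) e v ε
  leadingVec-∷ʳ-𝟘 {d} {e} e<d v ε = coeff-injective λ n → ≡.trans (coeff-∷ʳ (leadingVec d e v ε) 𝟘 n)
    (≡.trans (extend n) (≡.sym (coeff-leadingVec (ℕ.m<n⇒m<1+n e<d) v ε n)))
    where
    extend : ∀ n → leading d (leadingVec d e v ε) 𝟘 n ≡ leading e v ε n
    extend n with n ℕ.≟ d
    ... | yes n≡d = ≡.trans (leading-≡ (leadingVec d e v ε) 𝟘 n≡d) (≡.sym (leading-> v ε (ℕ.<-≤-trans e<d (ℕ.≤-reflexive (≡.sym n≡d)))))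
    ... | no n≢d = ≡.trans (leading-≢ (leadingVec d e v ε) 𝟘 n≢d) (coeff-leadingVec e<d v ε n)

  ∷ʳ-leadingVec : ∀ {d} (v : Coeffs d) (ε : Fin r) → v ∷ʳ ε ≡ leadingVec (suc d) d v ε
  ∷ʳ-leadingVec v ε = coeff-injective λ n → ≡.trans (coeff-∷ʳ v ε n) (≡.sym (coeff-leadingVec (ℕ.n<1+n _) v ε n))

module CoefficientSums {c ℓ} (R : CommutativeRing c ℓ) (ID : IsIntegralDomain R) {r : ℕ} (F : FiniteSubfield R r) (d₀ : ℕ) where
  open CommutativeRing R hiding (zero)
  open FiniteSubfield F
  open Setting R F d₀ using (vecs)
  open RingSum R
  open FiniteSubfieldProperties R ID F
  open CoefficientVectors F d₀
  open import Relation.Binary.Reasoning.Setoid setoid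

  ∑-vecs-∷ : ∀ e G → ∑ (vecs (suc e)) G ≈ ∑ (allFin r) (λ x → ∑ (vecs e) (λ v → G (x ∷ v)))
  ∑-vecs-∷ e G = trans (∑-concatMap (λ x → List.map (x ∷_) (vecs e)) (allFin r) G)
                       (∑-cong (allFin r) (λ x → reflexive (∑-map (x ∷_) (vecs e) G)))

  ∑-vecs-∷ʳ : ∀ e G → ∑ (vecs (suc e)) G ≈ ∑ (vecs e) (λ v → ∑ (allFin r) (λ x → G (v ∷ʳ x)))
  ∑-vecs-∷ʳ zero G = trans (∑-vecs-∷ zero G) (trans (∑-cong (allFin r) (λ x → +-identityʳ _)) (sym (+-identityʳ _)))
  ∑-vecs-∷ʳ (suc e) G = begin
    ∑ (vecs (2 ℕ.+ e)) G                                                    ≈⟨ ∑-vecs-∷ (suc e) G ⟩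
    ∑ (allFin r) (λ y → ∑ (vecs (suc e)) (λ u → G (y ∷ u)))                  ≈⟨ ∑-cong (allFin r) (λ y → ∑-vecs-∷ʳ e (λ u → G (y ∷ u))) ⟩
    ∑ (allFin r) (λ y → ∑ (vecs e) (λ v → ∑ (allFin r) (λ x → G (y ∷ (v ∷ʳ x))))) ≈⟨ ∑-vecs-∷ e (λ v → ∑ (allFin r) (λ x → G (v ∷ʳ x))) ⟨
    ∑ (vecs (suc e)) (λ v → ∑ (allFin r) (λ x → G (v ∷ʳ x)))                ∎

  SumInvariant : (Fin r → Fin r) → Set (c ⊔ ℓ)
  SumInvariant τ = ∀ f → ∑ (allFin r) (λ x → f (τ x)) ≈ ∑ (allFin r) f

  ∑-vecs-zipWith : ∀ {e} (σ : Fin r → Fin r → Fin r) (w : Coeffs e) → (∀ i → SumInvariant (σ (lookup w i))) →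
                   ∀ G → ∑ (vecs e) (λ v → G (zipWith σ w v)) ≈ ∑ (vecs e) G
  ∑-vecs-zipWith σ [] σ-inv G = refl
  ∑-vecs-zipWith {suc e} σ (p ∷ w) σ-inv G = begin
    ∑ (vecs (suc e)) (λ v → G (zipWith σ (p ∷ w) v))
      ≈⟨ ∑-vecs-∷ e _ ⟩
    ∑ (allFin r) (λ x → ∑ (vecs e) (λ v → G (σ p x ∷ zipWith σ w v)))
      ≈⟨ ∑-cong (allFin r) (λ x → ∑-vecs-zipWith σ w (σ-inv ∘ Fin.suc) (λ v → G (σ p x ∷ v))) ⟩
    ∑ (allFin r) (λ x → ∑ (vecs e) (λ v → G (σ p x ∷ v)))
      ≈⟨ σ-inv Fin.zero (λ y → ∑ (vecs e) (λ v → G (y ∷ v))) ⟩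
    ∑ (allFin r) (λ y → ∑ (vecs e) (λ v → G (y ∷ v)))
      ≈⟨ ∑-vecs-∷ e G ⟨
    ∑ (vecs (suc e)) G ∎

  ∑-vecs-decompose : ∀ d G →
                     ∑ (vecs d) G ≈ G 0ᵥ + ∑ (upTo d) (λ e → ∑ units (λ ε → ∑ (vecs e) (λ v → G (leadingVec d e v ε))))
  ∑-vecs-decompose zero G = refl
  ∑-vecs-decompose (suc d) G = begin
    ∑ (vecs (suc d)) G
      ≈⟨ ∑-vecs-∷ʳ d G ⟩
    ∑ (vecs d) (λ v → ∑ (allFin r) (λ x → G (v ∷ʳ x)))
      ≈⟨ ∑-cong (vecs d) (λ v → ∑-allFin-extract 𝟘 (λ x → G (v ∷ʳ x))) ⟩
    ∑ (vecs d) (λ v → G (v ∷ʳ 𝟘) + ∑ units (λ x → G (v ∷ʳ x)))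
      ≈⟨ ∑-distrib-∙ (vecs d) _ _ ⟩
    ∑ (vecs d) (λ v → G (v ∷ʳ 𝟘)) + ∑ (vecs d) (λ v → ∑ units (λ x → G (v ∷ʳ x)))
      ≈⟨ +-cong (∑-vecs-decompose d (λ v → G (v ∷ʳ 𝟘))) top ⟩
    (G (0ᵥ ∷ʳ 𝟘) + ∑ (upTo d) (λ e → ∑ units (λ ε → ∑ (vecs e) (λ v → G (leadingVec d e v ε ∷ʳ 𝟘))))) + T d
      ≈⟨ +-congʳ (+-cong (reflexive (≡.cong G (0ᵥ-∷ʳ d))) (∑-upTo-cong d (λ e e<d → ∑-cong units (λ ε → ∑-cong (vecs e) (λ v →
           reflexive (≡.cong G (leadingVec-∷ʳ-𝟘 e<d v ε))))))) ⟩
    (G 0ᵥ + ∑ (upTo d) T) + T d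
      ≈⟨ +-assoc _ _ _ ⟩
    G 0ᵥ + (∑ (upTo d) T + T d)
      ≈⟨ +-congˡ (∑-upTo-suc d T) ⟨
    G 0ᵥ + ∑ (upTo (suc d)) T ∎
    where
    T : ℕ → Carrier
    T e = ∑ units (λ ε → ∑ (vecs e) (λ v → G (leadingVec (suc d) e v ε)))
    top : ∑ (vecs d) (λ v → ∑ units (λ x → G (v ∷ʳ x))) ≈ T d
    top = trans (∑-comm (vecs d) units _) (∑-cong units (λ x → ∑-cong (vecs d) (λ v → reflexive (≡.cong G (∷ʳ-leadingVec v x)))))

module PowerSumProducts {c ℓ} (R : CommutativeRing c ℓ) (ID : IsIntegralDomain R) {r : ℕ} (F : FiniteSubfield R r) (d₀ : ℕ) where
  open CommutativeRing R hiding (zero)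
  open FiniteSubfield F
  open Setting R F d₀ using (Poly; _+ₚ_; _·ₚ_; IsMonic; monicPoly; monicPoly-isMonic; vecs; module Sums; Δ)
  open IntegerCoefficientSolver R
  open RingSum R
  open PairSums R
  open PartialFractions R
  open IntegralDomainProperties R ID using (inverse-unique)
  open SubfieldArithmetic F
  open FiniteSubfieldProperties R ID F
  open PowerSums R ID F
  open CoefficientVectors F d₀
  open CoefficientSums R ID F d₀
  open import Algebra.Definitions.RawSemiring (Semiring.rawSemiring semiring) using (_^_)
  open import Algebra.Properties.Semiring.Exp semiring using (^-congˡ; ^-homo-*)
  open import Algebra.Properties.CommutativeSemiring.Exp commutativeSemiring using (^-distrib-*)
  open import Relation.Binary.Reasoning.Setoid setoid

  -- Matching on (r ∸ 1) ∣? j also unfolds Δ in the goal to the corresponding branch.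
  Δ-powerSum : ∀ r′ s′ i j → (leftCoeff (suc s′) j + rightCoeff (suc r′) j) * powerSum j ≈ Δ (suc r′) (suc s′) i j
  Δ-powerSum r′ s′ i j with (r ∸ 1) ∣? j
  ... | yes r-1∣j = begin
    (sign (suc s′) * bin s′ + sign j * sign (suc r′) * bin r′) * powerSum j
      ≈⟨ *-cong (+-congˡ (*-congʳ (*-congʳ (-1^j≈1 r-1∣j)))) (powerSum-divisible r-1∣j) ⟩
    (sign (suc s′) * bin s′ + 1# * sign (suc r′) * bin r′) * - 1#
      ≈⟨ solve 4 (λ S R Bs Br → ((:- con (+ 1) :* S) :* Bs :+ con (+ 1) :* (:- con (+ 1) :* R) :* Br) :* (:- con (+ 1))
                                := R :* Br :+ S :* Bs) refl (sign s′) (sign r′) (bin s′) (bin r′) ⟩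
    sign r′ * bin r′ + sign s′ * bin s′ ∎
    where
    bin : ℕ → Carrier
    bin = binomial (j ∸ 1)
  ... | no r-1∤j = begin
    (leftCoeff (suc s′) j + rightCoeff (suc r′) j) * powerSum j  ≈⟨ *-congˡ (powerSum-indivisible r-1∤j) ⟩
    (leftCoeff (suc s′) j + rightCoeff (suc r′) j) * 0#          ≈⟨ zeroʳ _ ⟩
    0#                                                           ∎

  module _ (br : Poly → Carrier)
           (br-+ : ∀ a b → br (a +ₚ b) ≈ br a + br b)
           (br-· : ∀ ε a → br (ε ·ₚ a) ≈ emb ε * br a)
           (unit : ∀ a → IsMonic a → Σ Carrier (λ y → br a * y ≈ 1#)) where
    open Sums br unit

    inv-spec : ∀ e (e<d₀ : e ℕ.< d₀) cs → br (monicPoly e e<d₀ cs) * inv e e<d₀ cs ≈ 1#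
    inv-spec e e<d₀ cs = proj₂ (unit (monicPoly e e<d₀ cs) (monicPoly-isMonic e e<d₀ cs))

    -- inv with the bound e < d₀ decided rather than supplied, so that it can be summed over e.
    inv′ : ∀ e → Coeffs e → Carrier
    inv′ e cs with e ℕ.<? d₀
    ... | yes e<d₀ = inv e e<d₀ cs
    ... | no _ = 0#

    inv′≈inv : ∀ {e} (e<d₀ : e ℕ.< d₀) cs → inv′ e cs ≈ inv e e<d₀ cs
    inv′≈inv {e} e<d₀ cs with e ℕ.<? d₀
    ... | yes e<d₀′ = inverse-unique (inv-spec e e<d₀′ cs) (inv-spec e e<d₀ cs)
    ... | no e≮d₀ = ⊥-elim (e≮d₀ e<d₀)

    H-single : ∀ {d} (d<d₀ : d ℕ.< d₀) s → H d d<d₀ (s ∷ []) ≈ ∑ (vecs d) (λ a → inv d d<d₀ a ^ s)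
    H-single {d} d<d₀ s = ∑-cong (vecs d) (λ a → *-identityʳ _)

    H<-single : ∀ j {d} (d<d₀ : d ℕ.< d₀) → H< d d<d₀ (j ∷ []) ≈ ∑ (upTo d) (λ e → ∑ (vecs e) (λ cs → inv′ e cs ^ j))
    H<-single j {zero} d<d₀ = refl
    H<-single j {suc e} e+1<d₀ = begin
      H e e<d₀ (j ∷ []) + H< e e<d₀ (j ∷ [])
        ≈⟨ +-cong (trans (H-single e<d₀ j) (∑-cong (vecs e) (λ cs → ^-congˡ j (sym (inv′≈inv e<d₀ cs))))) (H<-single j e<d₀) ⟩
      Q e + ∑ (upTo e) Q
        ≈⟨ +-comm _ _ ⟩
      ∑ (upTo e) Q + Q e
        ≈⟨ ∑-upTo-suc e Q ⟨
      ∑ (upTo (suc e)) Q ∎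
      where
      e<d₀ = ℕ.<-trans (ℕ.n<1+n e) e+1<d₀
      Q : ℕ → Carrier
      Q e = ∑ (vecs e) (λ cs → inv′ e cs ^ j)

    module _ {d} (d<d₀ : d ℕ.< d₀) (r′ s′ : ℕ) where
      -- x a = [a]⁻¹ for the monic polynomial of degree d with lower coefficients a, S = H_d, Q = H_{<d},
      -- and w e ε cs = [u]⁻¹ for u = ε (θ^e + cs).
      private
        r₁ s₁ n : ℕ
        r₁ = suc r′
        s₁ = suc s′
        n = r₁ ℕ.+ s₁

        x : Coeffs d → Carrier
        x = inv d d<d₀

        S : ℕ → Carrier
        S i = ∑ (vecs d) (λ a → x a ^ i)

        Q : ℕ → Carrier
        Q j = ∑ (upTo d) (λ e → ∑ (vecs e) (λ cs → inv′ e cs ^ j))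

        u : ∀ e → Fin r → Coeffs e → Coeffs d
        u e ε cs = leadingVec d e (ε ·ᵥ cs) ε

        w : ∀ e → Fin r → Coeffs e → Carrier
        w e ε cs = emb (recip ε) * inv′ e cs

        t : Coeffs d → ∀ e → Fin r → Coeffs e → ℕ → ℕ → Carrier
        t a e ε cs = term r₁ s₁ (x a) (x (a -ᵥ u e ε cs)) (w e ε cs)

        K : ℕ → ℕ → Carrier
        K i j = (leftCoeff s₁ j + rightCoeff r₁ j) * S i

      partial-fraction-step : ∀ a {e} → e ℕ.< d → ∀ {ε} → ε ≢ 𝟘 → ∀ cs →
                              x a ^ r₁ * x (a -ᵥ u e ε cs) ^ s₁ ≈ sumPairs n (t a e ε cs)
      partial-fraction-step a {e} e<d {ε} ε≢𝟘 cs = partialFractions xy≈wy-wx r′ s′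
        where
        e<d₀ = ℕ.<-trans e<d d<d₀
        [u]w≈1 : br (embed (u e ε cs)) * w e ε cs ≈ 1#
        [u]w≈1 = begin
          br (embed (u e ε cs)) * (emb (recip ε) * inv′ e cs)
            ≈⟨ *-cong (trans (reflexive (≡.cong br (embed-leadingVec e<d (ℕ.<⇒≤ d<d₀) e<d₀ ε cs))) (br-· ε _)) (*-congˡ (inv′≈inv e<d₀ cs)) ⟩
          (emb ε * br (monicPoly e e<d₀ cs)) * (emb (recip ε) * inv e e<d₀ cs)
            ≈⟨ solve 4 (λ a b c d → (a :* b) :* (c :* d) := (a :* c) :* (b :* d)) refl _ _ _ _ ⟩
          (emb ε * emb (recip ε)) * (br (monicPoly e e<d₀ cs) * inv e e<d₀ cs)
            ≈⟨ *-cong (*-recip ε≢𝟘) (inv-spec e e<d₀ cs) ⟩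
          1# * 1#
            ≈⟨ *-identityˡ 1# ⟩
          1# ∎
        xy≈wy-wx = reciprocal-difference (trans (reflexive (≡.cong br (monicPoly-split d<d₀ a (u e ε cs)))) (br-+ _ _))
                     (inv-spec d d<d₀ a) (inv-spec d d<d₀ (a -ᵥ u e ε cs)) [u]w≈1

      difference-expansion : ∀ a → ∑ (vecs d) (λ v → x a ^ r₁ * x (a -ᵥ v) ^ s₁)
                                   ≈ x a ^ n + ∑ (upTo d) (λ e → ∑ units (λ ε → ∑ (vecs e) (λ cs → sumPairs n (t a e ε cs))))
      difference-expansion a =
        trans (∑-vecs-decompose d g) (+-cong g0≈x^n (∑-upTo-cong d (λ e e<d → ∑-units-cong (λ ε≢𝟘 → expand e<d ε≢𝟘))))
        where
        g : Coeffs d → Carrier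
        g v = x a ^ r₁ * x (a -ᵥ v) ^ s₁
        g0≈x^n : g 0ᵥ ≈ x a ^ n
        g0≈x^n = trans (*-congˡ (reflexive (≡.cong (λ b → x b ^ s₁) (-ᵥ-identityʳ a)))) (sym (^-homo-* (x a) r₁ s₁))
        expand : ∀ {e} → e ℕ.< d → ∀ {ε} → ε ≢ 𝟘 →
                 ∑ (vecs e) (λ v → g (leadingVec d e v ε)) ≈ ∑ (vecs e) (λ cs → sumPairs n (t a e ε cs))
        expand {e} e<d {ε} ε≢𝟘 = begin
          ∑ (vecs e) (λ v → g (leadingVec d e v ε))   ≈⟨ ∑-vecs-zipWith _⊗_ (replicate e ε) scale-invariant (λ v → g (leadingVec d e v ε)) ⟨
          ∑ (vecs e) (λ cs → g (u e ε cs))             ≈⟨ ∑-cong (vecs e) (partial-fraction-step a e<d ε≢𝟘) ⟩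
          ∑ (vecs e) (λ cs → sumPairs n (t a e ε cs))  ∎
          where
          scale-invariant : ∀ i → SumInvariant (lookup (replicate e ε) i ⊗_)
          scale-invariant i rewrite Vec.lookup-replicate i ε = ∑-allFin-scale ε≢𝟘

      H-pair : ∀ i j → H d d<d₀ (i ∷ j ∷ []) ≈ S i * Q j
      H-pair i j = trans (∑-cong (vecs d) (λ a → *-congˡ (H<-single j d<d₀))) (sym (*-distribʳ-∑ (Q j) (vecs d) _))

      product-as-double-sum : H d d<d₀ (r₁ ∷ []) * H d d<d₀ (s₁ ∷ [])
                              ≈ ∑ (vecs d) (λ a → ∑ (vecs d) (λ v → x a ^ r₁ * x (a -ᵥ v) ^ s₁))
      product-as-double-sum = begin
        H d d<d₀ (r₁ ∷ []) * H d d<d₀ (s₁ ∷ [])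
          ≈⟨ *-cong (H-single d<d₀ r₁) (H-single d<d₀ s₁) ⟩
        S r₁ * S s₁
          ≈⟨ *-distribʳ-∑ (S s₁) (vecs d) _ ⟩
        ∑ (vecs d) (λ a → x a ^ r₁ * S s₁)
          ≈⟨ ∑-cong (vecs d) (λ a → *-distribˡ-∑ (x a ^ r₁) (vecs d) _) ⟩
        ∑ (vecs d) (λ a → ∑ (vecs d) (λ b → x a ^ r₁ * x b ^ s₁))
          ≈⟨ ∑-cong (vecs d) (λ a → ∑-vecs-zipWith _ a (λ i → ∑-allFin-permute (reflection (lookup a i))) _) ⟨
        ∑ (vecs d) (λ a → ∑ (vecs d) (λ v → x a ^ r₁ * x (a -ᵥ v) ^ s₁)) ∎

      ∑-term : ∀ e ε cs i j → ∑ (vecs d) (λ a → t a e ε cs i j) ≈ K i j * w e ε cs ^ j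
      ∑-term e ε cs i j = begin
        ∑ (vecs d) (λ a → (α * x a ^ i + β * x (a -ᵥ v) ^ i) * W)
          ≈⟨ ∑-cong (vecs d) (λ a → solve 5 (λ α β X Y W → (α :* X :+ β :* Y) :* W := α :* W :* X :+ β :* W :* Y) refl α β _ _ W) ⟩
        ∑ (vecs d) (λ a → α * W * x a ^ i + β * W * x (a -ᵥ v) ^ i)
          ≈⟨ ∑-distrib-∙ (vecs d) _ _ ⟩
        ∑ (vecs d) (λ a → α * W * x a ^ i) + ∑ (vecs d) (λ a → β * W * x (a -ᵥ v) ^ i)
          ≈⟨ +-cong (*-distribˡ-∑ (α * W) (vecs d) _) (*-distribˡ-∑ (β * W) (vecs d) _) ⟨
        α * W * S i + β * W * ∑ (vecs d) (λ a → x (a -ᵥ v) ^ i)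
          ≈⟨ +-congˡ (*-congˡ shift) ⟩
        α * W * S i + β * W * S i
          ≈⟨ solve 4 (λ α β W Sᵢ → α :* W :* Sᵢ :+ β :* W :* Sᵢ := (α :+ β) :* Sᵢ :* W) refl α β W (S i) ⟩
        K i j * W ∎
        where
        α = leftCoeff s₁ j
        β = rightCoeff r₁ j
        v = u e ε cs
        W = w e ε cs ^ j
        shift : ∑ (vecs d) (λ a → x (a -ᵥ v) ^ i) ≈ S i
        shift = trans (∑-cong (vecs d) (λ a → reflexive (≡.cong (λ b → x b ^ i) (Vec.zipWith-comm (λ _ _ → ≡.refl) a v))))
                      (∑-vecs-zipWith _ v (λ k → ∑-allFin-permute (Permutation.flip (translation (lookup v k)))) (λ a → x a ^ i))

      coefficient-sum : ∀ i j → ∑ (upTo d) (λ e → ∑ units (λ ε → ∑ (vecs e) (λ cs → K i j * w e ε cs ^ j)))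
                                ≈ Δ r₁ s₁ i j * H d d<d₀ (i ∷ j ∷ [])
      coefficient-sum i j = begin
        ∑ (upTo d) (λ e → ∑ units (λ ε → ∑ (vecs e) (λ cs → K i j * w e ε cs ^ j)))
          ≈⟨ ∑-cong (upTo d) (λ e → ∑-cong units (λ ε → split-w e ε)) ⟩
        ∑ (upTo d) (λ e → ∑ units (λ ε → K i j * Z e * emb (recip ε) ^ j))
          ≈⟨ ∑-cong (upTo d) (λ e → *-distribˡ-∑ (K i j * Z e) units _) ⟨
        ∑ (upTo d) (λ e → K i j * Z e * ∑ units (λ ε → emb (recip ε) ^ j))
          ≈⟨ ∑-cong (upTo d) (λ e → *-congˡ (∑-units-recip (λ ε → emb ε ^ j))) ⟩
        ∑ (upTo d) (λ e → K i j * Z e * powerSum j)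
          ≈⟨ ∑-cong (upTo d) (λ e → solve 3 (λ k z p → k :* z :* p := k :* p :* z) refl _ _ _) ⟩
        ∑ (upTo d) (λ e → K i j * powerSum j * Z e)
          ≈⟨ *-distribˡ-∑ (K i j * powerSum j) (upTo d) Z ⟨
        K i j * powerSum j * Q j
          ≈⟨ solve 4 (λ c s p q → c :* s :* p :* q := c :* p :* (s :* q)) refl _ (S i) _ _ ⟩
        (leftCoeff s₁ j + rightCoeff r₁ j) * powerSum j * (S i * Q j)
          ≈⟨ *-cong (sym (Δ-powerSum r′ s′ i j)) (H-pair i j) ⟨
        Δ r₁ s₁ i j * H d d<d₀ (i ∷ j ∷ []) ∎
        where
        Z : ℕ → Carrier
        Z e = ∑ (vecs e) (λ cs → inv′ e cs ^ j)
        split-w : ∀ e ε → ∑ (vecs e) (λ cs → K i j * w e ε cs ^ j) ≈ K i j * Z e * emb (recip ε) ^ j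
        split-w e ε = begin
          ∑ (vecs e) (λ cs → K i j * (emb (recip ε) * inv′ e cs) ^ j)
            ≈⟨ ∑-cong (vecs e) (λ cs → *-congˡ (^-distrib-* _ _ j)) ⟩
          ∑ (vecs e) (λ cs → K i j * (emb (recip ε) ^ j * inv′ e cs ^ j))
            ≈⟨ ∑-cong (vecs e) (λ cs → solve 3 (λ k ρ ι → k :* (ρ :* ι) := k :* ρ :* ι) refl _ _ _) ⟩
          ∑ (vecs e) (λ cs → K i j * emb (recip ε) ^ j * inv′ e cs ^ j)
            ≈⟨ *-distribˡ-∑ _ (vecs e) _ ⟨
          K i j * emb (recip ε) ^ j * Z e
            ≈⟨ solve 3 (λ k ρ z → k :* ρ :* z := k :* z :* ρ) refl _ _ _ ⟩
          K i j * Z e * emb (recip ε) ^ j ∎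

      H-product : H d d<d₀ (r₁ ∷ []) * H d d<d₀ (s₁ ∷ [])
                  ≈ H d d<d₀ (n ∷ []) + sumPairs n (λ i j → Δ r₁ s₁ i j * H d d<d₀ (i ∷ j ∷ []))
      H-product = begin
        H d d<d₀ (r₁ ∷ []) * H d d<d₀ (s₁ ∷ [])
          ≈⟨ product-as-double-sum ⟩
        ∑ (vecs d) (λ a → ∑ (vecs d) (λ v → x a ^ r₁ * x (a -ᵥ v) ^ s₁))
          ≈⟨ ∑-cong (vecs d) difference-expansion ⟩
        ∑ (vecs d) (λ a → x a ^ n + ∑ (upTo d) (λ e → ∑ units (λ ε → ∑ (vecs e) (λ cs → sumPairs n (t a e ε cs)))))
          ≈⟨ ∑-distrib-∙ (vecs d) _ _ ⟩
        S n + ∑ (vecs d) (λ a → ∑ (upTo d) (λ e → ∑ units (λ ε → ∑ (vecs e) (λ cs → sumPairs n (t a e ε cs)))))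
          ≈⟨ +-cong (sym (H-single d<d₀ n))
                    (trans sum-a-innermost (trans sum-pairs-outermost
                      (∑-cong (upTo (n ∸ 1)) (λ k → coefficient-sum (suc k) (n ∸ suc k))))) ⟩
        H d d<d₀ (n ∷ []) + sumPairs n (λ i j → Δ r₁ s₁ i j * H d d<d₀ (i ∷ j ∷ [])) ∎
        where
        sum-a-innermost : ∑ (vecs d) (λ a → ∑ (upTo d) (λ e → ∑ units (λ ε → ∑ (vecs e) (λ cs → sumPairs n (t a e ε cs)))))
                          ≈ ∑ (upTo d) (λ e → ∑ units (λ ε → ∑ (vecs e) (λ cs → sumPairs n (λ i j → K i j * w e ε cs ^ j))))
        sum-a-innermost = trans (∑-comm (vecs d) (upTo d) _) (∑-cong (upTo d) λ e →
                          trans (∑-comm (vecs d) units _) (∑-cong units λ ε →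
                          trans (∑-comm (vecs d) (vecs e) _) (∑-cong (vecs e) λ cs →
                          trans (∑-sumPairs (vecs d) n (λ a → t a e ε cs))
                                (∑-cong (upTo (n ∸ 1)) λ k → ∑-term e ε cs (suc k) (n ∸ suc k)))))
        sum-pairs-outermost : ∑ (upTo d) (λ e → ∑ units (λ ε → ∑ (vecs e) (λ cs → sumPairs n (λ i j → K i j * w e ε cs ^ j))))
                              ≈ sumPairs n (λ i j → ∑ (upTo d) (λ e → ∑ units (λ ε → ∑ (vecs e) (λ cs → K i j * w e ε cs ^ j))))
        sum-pairs-outermost =
          trans (∑-cong (upTo d) λ e →
                  trans (∑-cong units λ ε → ∑-sumPairs (vecs e) n (λ cs i j → K i j * w e ε cs ^ j))
                        (∑-sumPairs units n (λ ε i j → ∑ (vecs e) (λ cs → K i j * w e ε cs ^ j))))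
                (∑-sumPairs (upTo d) n (λ e i j → ∑ units (λ ε → ∑ (vecs e) (λ cs → K i j * w e ε cs ^ j))))

open import Data.Nat using (_<_; _^_)
open import Data.Nat.Primality using (Prime)

lemma3p9 : ∀ {c ℓ} (R : CommutativeRing c ℓ) → IsIntegralDomain R →
  (p n r : ℕ) → Prime p → r ≡ p ^ n → (F : FiniteSubfield R r) → (d₀ : ℕ) →
  let open CommutativeRing R
      open FiniteSubfield F
      open Setting R F d₀
  in (br : Poly → Carrier) →
     (∀ a b → br (a +ₚ b) ≈ br a + br b) →
     (∀ ε a → br (ε ·ₚ a) ≈ emb ε * br a) →
     (unit : ∀ a → IsMonic a → Σ Carrier (λ y → br a * y ≈ 1#)) →
     let open Sums br unit
     in (d : ℕ) (d<d₀ : d < d₀) (r₁ s₁ : ℕ) → 0 < r₁ → 0 < s₁ →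
        H d d<d₀ (r₁ ∷ []) * H d d<d₀ (s₁ ∷ [])
          ≈ H d d<d₀ ((r₁ ℕ.+ s₁) ∷ [])
            + ΣPairs (r₁ ℕ.+ s₁) (λ i j → Δ r₁ s₁ i j * H d d<d₀ (i ∷ j ∷ []))
lemma3p9 R ID _ _ _ _ _ F d₀ br br-+ br-· unit d d<d₀ (suc r′) (suc s′) _ _ =
  PowerSumProducts.H-product R ID F d₀ br br-+ br-· unit d<d₀ r′ s′
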